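{- Let $p$ be an odd prime. Then the wreath product $\mathbb{Z}_p \wr \mathbb{Z}_p$ is not GRR-detecting (and is therefore also not DRR-detecting).
   Context: All groups and graphs are finite. $\mathbb{Z}_p$ is the cyclic group of order $p$, and $\mathbb{Z}_p \wr \mathbb{Z}_p = \mathbb{Z}_p \ltimes (\mathbb{Z}_p)^p$, where $\mathbb{Z}_p$ acts on $(\mathbb{Z}_p)^p$ by cyclically permuting the coordinates. For a subset $S$ of a group $G$, the Cayley digraph $\mathrm{Cay}(G,S)$ has vertex set $G$ and a directed edge from $g_1$ to $g_2$ iff $g_2 = s g_1$ for some $s \in S$; if $S$ is inverse-closed it is a graph (Cayley graph). $\mathrm{Aut}(G,S) = \{\varphi \in \mathrm{Aut}(G) : \varphi(S) = S\}$. A digraph $\Gamma$ is a DRR (digraphical regular representation) of $G$ if $\mathrm{Aut}(\Gamma) \cong G$ and acts regularly on the vertices; a GRR is a DRR that is a graph. $G$ is GRR-detecting if for every inverse-closed $S \subseteq G$, $\mathrm{Aut}(G,S)=\{1\}$ implies $\mathrm{Cay}(G,S)$ is a GRR; $G$ is DRR-detecting if for every $S \subseteq G$, $\mathrm{Aut}(G,S)=\{1\}$ implies $\mathrm{Cay}(G,S)$ is a DRR. -}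

module Defs where

open import Data.Nat using (ℕ; _+_; _∸_; NonZero)
open import Data.Nat.DivMod using (_%_; m%n<n)
open import Data.Nat.Primality using (Prime; prime⇒nonZero)
open import Data.Fin using (Fin; toℕ; fromℕ<)
open import Data.Vec using (Vec; tabulate; lookup)
open import Data.Bool using (Bool; true)
open import Data.Product using (_×_; _,_; ∃)
open import Relation.Binary.PropositionalEquality using (_≡_)

-- A group presented by its operations (carrier with propositional
-- equality).  The group laws are not needed to *state* the notions below.

record GroupData : Set₁ where
  field
    Carrier : Set
    _∙_     : Carrier → Carrier → Carrier
    ε       : Carrier
    _⁻¹     : Carrier → Carrier

record Perm (A : Set) : Set where
  field
    to      : A → A
    from    : A → A
    to-from : ∀ x → to (from x) ≡ x
    from-to : ∀ x → from (to x) ≡ x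

module _ (G : GroupData) where
  open GroupData G

  Subset : Set
  Subset = Carrier → Bool

  InverseClosed : Subset → Set
  InverseClosed S = ∀ g → S (g ⁻¹) ≡ S g

  record GroupAut : Set where
    field
      perm : Perm Carrier
    open Perm perm public
    field
      hom : ∀ x y → to (x ∙ y) ≡ to x ∙ to y

  AutGS-trivial : Subset → Set
  AutGS-trivial S =
    (φ : GroupAut) → (∀ g → S (GroupAut.to φ g) ≡ S g) →
    ∀ g → GroupAut.to φ g ≡ g

  -- Cay(G,S): an arc g₁ → g₂ iff g₂ = s g₁ for some s ∈ S, i.e. g₂ g₁⁻¹ ∈ S
  CayArc : Subset → Carrier → Carrier → Bool
  CayArc S g₁ g₂ = S (g₂ ∙ (g₁ ⁻¹))

  record CayAut (S : Subset) : Set where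
    field
      perm : Perm Carrier
    open Perm perm public
    field
      arcs : ∀ x y → CayArc S (to x) (to y) ≡ CayArc S x y

  -- Cay(G,S) is a DRR: Aut(Cay(G,S)) is exactly the (regular) group of
  -- right translations g ↦ g h, i.e. Aut(Γ) = G_R ≅ G acting regularly.
  IsDRR : Subset → Set
  IsDRR S = (σ : CayAut S) → ∃ λ h → ∀ g → CayAut.to σ g ≡ g ∙ h

  -- a GRR is a DRR that is a graph (S inverse-closed)
  IsGRR : Subset → Set
  IsGRR S = InverseClosed S × IsDRR S

  GRRDetecting : Set
  GRRDetecting = (S : Subset) → InverseClosed S → AutGS-trivial S → IsGRR S

  DRRDetecting : Set
  DRRDetecting = (S : Subset) → AutGS-trivial S → IsDRR S

-- The wreath product Z_p ≀ Z_p = Z_p ⋉ (Z_p)^p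

module _ (p : ℕ) .{{_ : NonZero p}} where

  infixl 6 _+ₚ_

  _+ₚ_ : Fin p → Fin p → Fin p
  a +ₚ b = fromℕ< (m%n<n (toℕ a + toℕ b) p)

  -ₚ_ : Fin p → Fin p
  -ₚ a = fromℕ< (m%n<n (p ∸ toℕ a) p)

  0ₚ : Fin p
  0ₚ = fromℕ< (m%n<n 0 p)

  rot : Fin p → Vec (Fin p) p → Vec (Fin p) p
  rot a w = tabulate λ i → lookup w (i +ₚ (-ₚ a))

  vadd : Vec (Fin p) p → Vec (Fin p) p → Vec (Fin p) p
  vadd v w = tabulate λ i → lookup v i +ₚ lookup w i

  vneg : Vec (Fin p) p → Vec (Fin p) p
  vneg v = tabulate λ i → -ₚ lookup v i

  vzero : Vec (Fin p) p
  vzero = tabulate λ _ → 0ₚ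

  WreathData : GroupData
  WreathData = record
    { Carrier = Fin p × Vec (Fin p) p
    ; _∙_     = λ { (a , v) (b , w) → (a +ₚ b , vadd v (rot a w)) }
    ; ε       = (0ₚ , vzero)
    ; _⁻¹     = λ { (a , v) → (-ₚ a , vneg (rot (-ₚ a) v)) }
    }

ZpWrZp : (p : ℕ) → Prime p → GroupData
ZpWrZp p pp = WreathData p {{prime⇒nonZero pp}}

{-# OPTIONS --safe #-}
module Submission where

open import Defs
open import Data.Nat using (ℕ)
open import Data.Nat.Primality using (Prime)
open import Data.Product using (_×_)
open import Relation.Nullary using (¬_)
open import Relation.Binary.PropositionalEquality using (_≢_)

open import Algebra.Bundles using (Group; AbelianGroup)
open import Algebra.Structures using (IsGroup; IsAbelianGroup)
import Algebra.Properties.AbelianGroup as AbelianGroupProperties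
import Algebra.Properties.CommutativeSemigroup as CommutativeSemigroupProperties
import Algebra.Properties.Group as GroupProperties
open import Data.Bool using (Bool; true; false; not; _xor_; if_then_else_)
import Data.Bool.Properties as Bool
open import Data.Bool.Properties using (not-involutive; not-distribˡ-xor; not-distribʳ-xor)
open import Data.Empty using (⊥; ⊥-elim)
open import Data.Fin as Fin using (Fin; toℕ; fromℕ<)
open import Data.Fin.Properties using (suc-injective; toℕ-injective; toℕ-fromℕ<; fromℕ<-toℕ; toℕ<n; _≟_; all?)
open import Data.Nat as ℕ using (zero; suc; _∸_; NonZero)
open import Data.Nat.DivMod using (_%_; m%n<n; %-distribˡ-+; m%n%n≡m%n; m<n⇒m%n≡m; n%n≡0)
open import Data.Nat.Divisibility using (_∣_; _∣0; ∣-refl; ∣m∣n⇒∣m+n)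
open import Data.Nat.Primality using (¬prime[0]; ¬prime[1]; prime⇒irreducible)
import Data.Nat.Properties as ℕ
open import Data.Product using (Σ; _,_; proj₁; proj₂; ∃)
open import Data.Sum using (_⊎_; inj₁; inj₂)
import Data.Sum as Sum
open import Data.Vec using (Vec; lookup; tabulate; replicate; _[_]≔_)
open import Data.Vec.Functional using (foldr)
open import Data.Vec.Properties
  using (lookup-replicate; lookup∘tabulate; tabulate∘lookup; tabulate-cong;
         lookup∘update; lookup∘update′; []≔-idempotent; []≔-lookup)
open import Function using (_∘_)
open import Function.Bundles using (_⇔_; mk⇔)
open import Relation.Binary.PropositionalEquality
open import Relation.Binary.PropositionalEquality.Algebra using (isMagma)
open import Relation.Nullary using (Dec; does; yes; no; contradiction; ¬?)
open import Relation.Nullary.Decidable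
  using (map′; does-⇔; dec-true; dec-false; decidable-stable; _×-dec_; _⊎-dec_; _→-dec_)
open ≡-Reasoning

-- Write G = Zₚ ⋉ N with N = Zₚᵖ, and let t = (1 , 0) and e = (0 , δ₀); they generate G.
-- Let S consist of (0 , ±δ₀); of (1 , u) for u = 0, u = ±δ₀, or u a vector of entries ±1 with an
-- even number of entries -1; of the inverses of the latter; and of (c , 0) for c ∉ {0, ±1}.
--
-- The map σ negating the coordinates a and a + 1 of (a , v) is an automorphism of Cay(G , S):
-- σ y (σ x)⁻¹ is y x⁻¹ with two coordinates negated, which keeps each slice of S, including the
-- parity of the number of entries -1. It fixes the identity but moves e, so it is not a right
-- translation and Cay(G , S) is not a DRR.
--
-- Let φ ∈ Aut(G , S). An element outside N does not commute with its conjugate by e, whereas e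
-- commutes with all its conjugates; hence φ e ∈ N ∩ S, that is, φ e = (0 , ±δ₀). The vector part
-- of an element of S is supported on at most one coordinate or has no zero coordinate; applied to
-- the images of t, e t, e⁻¹ t and t², this forces φ t = t. So φ is the identity or (a , v) ↦ (a , -v),
-- and the latter maps (1 , (1, …, 1)) ∈ S to (1 , (-1, …, -1)) ∉ S because p is odd.

does≡true⇒ : ∀ {A : Set} (a? : Dec A) → does a? ≡ true → A
does≡true⇒ (yes a) _  = a
does≡true⇒ (no _)  ()

involution-invariant : ∀ {A : Set} (P : A → Set) (f : A → A) → (∀ x → f (f x) ≡ x) →
                       (∀ x → P x → P (f x)) → ∀ x → P (f x) ⇔ P x
involution-invariant P f f-involutive P-f x =
  mk⇔ (λ Pfx → subst P (f-involutive x) (P-f (f x) Pfx)) (P-f x)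

isGroup-≡ : {A : Set} {_∙_ : A → A → A} {ε : A} {_⁻¹ : A → A} →
  (∀ x y z → (x ∙ y) ∙ z ≡ x ∙ (y ∙ z)) →
  (∀ x → ε ∙ x ≡ x) → (∀ x → x ∙ ε ≡ x) →
  (∀ x → (x ⁻¹) ∙ x ≡ ε) → (∀ x → x ∙ (x ⁻¹) ≡ ε) →
  IsGroup _≡_ _∙_ ε _⁻¹
isGroup-≡ {_⁻¹ = _⁻¹} assoc identityˡ identityʳ inverseˡ inverseʳ = record
  { isMonoid = record
    { isSemigroup = record { isMagma = isMagma _ ; assoc = assoc }
    ; identity    = identityˡ , identityʳ
    }
  ; inverse  = inverseˡ , inverseʳ
  ; ⁻¹-cong  = cong _⁻¹
  }

module SemidirectProduct
  {H N : Set}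
  {_·_ : H → H → H} {1ₕ : H} {_⁻¹ₕ : H → H} (H-isGroup : IsGroup _≡_ _·_ 1ₕ _⁻¹ₕ)
  {plus : N → N → N} {0ₙ : N} {minus : N → N} (N-isGroup : IsGroup _≡_ plus 0ₙ minus)
  (θ : H → N → N)
  (θ-homo : ∀ a x y → θ a (plus x y) ≡ plus (θ a x) (θ a y))
  (θ-identity : ∀ x → θ 1ₕ x ≡ x)
  (θ-compose : ∀ a b x → θ a (θ b x) ≡ θ (a · b) x)
  where

  private
    infixl 6 _+_
    infix  8 -_
    _+_ : N → N → N
    _+_ = plus
    -_ : N → N
    -_ = minus

    module H = IsGroup H-isGroup
    module N = IsGroup N-isGroup

    N-group : Group _ _
    N-group = record { isGroup = N-isGroup }

    module NP = GroupProperties N-group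

  θ-zero : ∀ a → θ a 0ₙ ≡ 0ₙ
  θ-zero a = NP.identityˡ-unique (θ a 0ₙ) (θ a 0ₙ) (begin
    θ a 0ₙ + θ a 0ₙ  ≡⟨ θ-homo a 0ₙ 0ₙ ⟨
    θ a (0ₙ + 0ₙ)    ≡⟨ cong (θ a) (N.identityˡ 0ₙ) ⟩
    θ a 0ₙ           ∎)

  θ-inverse : ∀ a x → θ a (minus x) ≡ minus (θ a x)
  θ-inverse a x = NP.inverseʳ-unique (θ a x) (θ a (- x)) (begin
    θ a x + θ a (- x)  ≡⟨ θ-homo a x (- x) ⟨
    θ a (x + (- x))    ≡⟨ cong (θ a) (N.inverseʳ x) ⟩
    θ a 0ₙ             ≡⟨ θ-zero a ⟩
    0ₙ                 ∎)

  infixl 7 _∙_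
  _∙_ : H × N → H × N → H × N
  (a , v) ∙ (b , w) = (a · b , plus v (θ a w))

  ε : H × N
  ε = (1ₕ , 0ₙ)

  infix 8 _⁻¹
  _⁻¹ : H × N → H × N
  (a , v) ⁻¹ = (a ⁻¹ₕ , minus (θ (a ⁻¹ₕ) v))

  isGroup : IsGroup _≡_ _∙_ ε _⁻¹
  isGroup = isGroup-≡ assoc identityˡ identityʳ inverseˡ inverseʳ
    where
    assoc : ∀ x y z → (x ∙ y) ∙ z ≡ x ∙ (y ∙ z)
    assoc (a , u) (b , v) (c , w) = cong₂ _,_ (H.assoc a b c) (begin
      (u + θ a v) + θ (a · b) w       ≡⟨ N.assoc u (θ a v) (θ (a · b) w) ⟩
      u + (θ a v + θ (a · b) w)       ≡⟨ cong (λ z → u + (θ a v + z)) (θ-compose a b w) ⟨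
      u + (θ a v + θ a (θ b w))       ≡⟨ cong (u +_) (θ-homo a v (θ b w)) ⟨
      u + θ a (v + θ b w)             ∎)
    identityˡ : ∀ x → ε ∙ x ≡ x
    identityˡ (b , w) = cong₂ _,_ (H.identityˡ b) (trans (N.identityˡ (θ 1ₕ w)) (θ-identity w))
    identityʳ : ∀ x → x ∙ ε ≡ x
    identityʳ (a , v) = cong₂ _,_ (H.identityʳ a) (trans (cong (v +_) (θ-zero a)) (N.identityʳ v))
    inverseˡ : ∀ x → x ⁻¹ ∙ x ≡ ε
    inverseˡ (a , v) = cong₂ _,_ (H.inverseˡ a) (N.inverseˡ (θ (a ⁻¹ₕ) v))
    inverseʳ : ∀ x → x ∙ x ⁻¹ ≡ ε
    inverseʳ (a , v) = cong₂ _,_ (H.inverseʳ a) (begin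
      v + θ a (- (θ (a ⁻¹ₕ) v))   ≡⟨ cong (v +_) (θ-inverse a (θ (a ⁻¹ₕ) v)) ⟩
      v + - (θ a (θ (a ⁻¹ₕ) v))   ≡⟨ cong (λ z → v + - z) (θ-compose a (a ⁻¹ₕ) v) ⟩
      v + - (θ (a · (a ⁻¹ₕ)) v)   ≡⟨ cong (λ b → v + - (θ b v)) (H.inverseʳ a) ⟩
      v + - (θ 1ₕ v)              ≡⟨ cong (λ z → v + - z) (θ-identity v) ⟩
      v + (- v)                   ≡⟨ N.inverseʳ v ⟩
      0ₙ                          ∎)

module HomomorphismProperties
  {A B : Set}
  {_∙_ : A → A → A} {ε : A} {_⁻¹ : A → A} (A-isGroup : IsGroup _≡_ _∙_ ε _⁻¹)
  {_∙′_ : B → B → B} {ε′ : B} {_⁻¹′ : B → B} (B-isGroup : IsGroup _≡_ _∙′_ ε′ _⁻¹′)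
  (f : A → B) (homo : ∀ x y → f (x ∙ y) ≡ f x ∙′ f y)
  where

  private
    module A = IsGroup A-isGroup

    B-group : Group _ _
    B-group = record { isGroup = B-isGroup }

    module BP = GroupProperties B-group

  ε-homo : f ε ≡ ε′
  ε-homo = BP.identityˡ-unique (f ε) (f ε) (trans (sym (homo ε ε)) (cong f (A.identityˡ ε)))

  ⁻¹-homo : ∀ x → f (x ⁻¹) ≡ (f x) ⁻¹′
  ⁻¹-homo x = BP.inverseʳ-unique (f x) (f (x ⁻¹))
    (trans (sym (homo x (x ⁻¹))) (trans (cong f (A.inverseʳ x)) ε-homo))

module ModularArithmetic (p : ℕ) .{{_ : NonZero p}} where

  infixl 6 _⊕_
  _⊕_ : Fin p → Fin p → Fin p
  _⊕_ = _+ₚ_ p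

  ⊖_ : Fin p → Fin p
  ⊖_ = -ₚ_ p

  0# 1# : Fin p
  0# = 0ₚ p
  1# = fromℕ< (m%n<n 1 p)

  private
    toℕ-⊕ : ∀ a b → toℕ (a ⊕ b) ≡ (toℕ a ℕ.+ toℕ b) % p
    toℕ-⊕ a b = toℕ-fromℕ< _

    toℕ-0# : toℕ 0# ≡ 0
    toℕ-0# = trans (toℕ-fromℕ< _) (m<n⇒m%n≡m (ℕ.>-nonZero⁻¹ p))

    %-absorbˡ : ∀ m n → (m % p ℕ.+ n) % p ≡ (m ℕ.+ n) % p
    %-absorbˡ m n = begin
      (m % p ℕ.+ n) % p            ≡⟨ %-distribˡ-+ (m % p) n p ⟩
      (m % p % p ℕ.+ n % p) % p    ≡⟨ cong (λ k → (k ℕ.+ n % p) % p) (m%n%n≡m%n m p) ⟩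
      (m % p ℕ.+ n % p) % p        ≡⟨ %-distribˡ-+ m n p ⟨
      (m ℕ.+ n) % p                ∎

    %-absorbʳ : ∀ m n → (m ℕ.+ n % p) % p ≡ (m ℕ.+ n) % p
    %-absorbʳ m n = begin
      (m ℕ.+ n % p) % p   ≡⟨ cong (_% p) (ℕ.+-comm m (n % p)) ⟩
      (n % p ℕ.+ m) % p   ≡⟨ %-absorbˡ n m ⟩
      (n ℕ.+ m) % p       ≡⟨ cong (_% p) (ℕ.+-comm n m) ⟩
      (m ℕ.+ n) % p       ∎

    assoc : ∀ a b c → (a ⊕ b) ⊕ c ≡ a ⊕ (b ⊕ c)
    assoc a b c = toℕ-injective (begin
      toℕ ((a ⊕ b) ⊕ c)                        ≡⟨ toℕ-⊕ (a ⊕ b) c ⟩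
      (toℕ (a ⊕ b) ℕ.+ toℕ c) % p               ≡⟨ cong (λ k → (k ℕ.+ toℕ c) % p) (toℕ-⊕ a b) ⟩
      ((toℕ a ℕ.+ toℕ b) % p ℕ.+ toℕ c) % p     ≡⟨ %-absorbˡ (toℕ a ℕ.+ toℕ b) (toℕ c) ⟩
      (toℕ a ℕ.+ toℕ b ℕ.+ toℕ c) % p           ≡⟨ cong (_% p) (ℕ.+-assoc (toℕ a) (toℕ b) (toℕ c)) ⟩
      (toℕ a ℕ.+ (toℕ b ℕ.+ toℕ c)) % p         ≡⟨ %-absorbʳ (toℕ a) (toℕ b ℕ.+ toℕ c) ⟨
      (toℕ a ℕ.+ (toℕ b ℕ.+ toℕ c) % p) % p     ≡⟨ cong (λ k → (toℕ a ℕ.+ k) % p) (toℕ-⊕ b c) ⟨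
      (toℕ a ℕ.+ toℕ (b ⊕ c)) % p               ≡⟨ toℕ-⊕ a (b ⊕ c) ⟨
      toℕ (a ⊕ (b ⊕ c))                        ∎)

    comm : ∀ a b → a ⊕ b ≡ b ⊕ a
    comm a b = toℕ-injective (begin
      toℕ (a ⊕ b)               ≡⟨ toℕ-⊕ a b ⟩
      (toℕ a ℕ.+ toℕ b) % p     ≡⟨ cong (_% p) (ℕ.+-comm (toℕ a) (toℕ b)) ⟩
      (toℕ b ℕ.+ toℕ a) % p     ≡⟨ toℕ-⊕ b a ⟨
      toℕ (b ⊕ a)               ∎)

    identityˡ : ∀ a → 0# ⊕ a ≡ a
    identityˡ a = toℕ-injective (begin
      toℕ (0# ⊕ a)                ≡⟨ toℕ-⊕ 0# a ⟩
      (toℕ 0# ℕ.+ toℕ a) % p      ≡⟨ cong (λ k → (k ℕ.+ toℕ a) % p) toℕ-0# ⟩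
      toℕ a % p                   ≡⟨ m<n⇒m%n≡m (toℕ<n a) ⟩
      toℕ a                       ∎)

    inverseˡ : ∀ a → (⊖ a) ⊕ a ≡ 0#
    inverseˡ a = toℕ-injective (begin
      toℕ ((⊖ a) ⊕ a)                       ≡⟨ toℕ-⊕ (⊖ a) a ⟩
      (toℕ (⊖ a) ℕ.+ toℕ a) % p             ≡⟨ cong (λ k → (k ℕ.+ toℕ a) % p) (toℕ-fromℕ< _) ⟩
      ((p ∸ toℕ a) % p ℕ.+ toℕ a) % p       ≡⟨ %-absorbˡ (p ∸ toℕ a) (toℕ a) ⟩
      ((p ∸ toℕ a) ℕ.+ toℕ a) % p           ≡⟨ cong (_% p) (ℕ.m∸n+n≡m (ℕ.<⇒≤ (toℕ<n a))) ⟩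
      p % p                                 ≡⟨ n%n≡0 p ⟩
      0                                     ≡⟨ toℕ-0# ⟨
      toℕ 0#                                ∎)

  ⊕-isAbelianGroup : IsAbelianGroup _≡_ _⊕_ 0# ⊖_
  ⊕-isAbelianGroup = record
    { isGroup = isGroup-≡ assoc identityˡ (λ a → trans (comm a 0#) (identityˡ a))
                          inverseˡ (λ a → trans (comm a (⊖ a)) (inverseˡ a))
    ; comm    = comm
    }

  ⊕-abelianGroup : AbelianGroup _ _
  ⊕-abelianGroup = record { isAbelianGroup = ⊕-isAbelianGroup }

  ⊕1-induction : (P : Fin p → Set) → P 0# → (∀ a → P a → P (a ⊕ 1#)) → ∀ a → P a
  ⊕1-induction P P0 Psuc a = subst P (fromℕ<-toℕ a (toℕ<n a)) (from-ℕ (toℕ a) (toℕ<n a))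
    where
    from-ℕ : ∀ m (m<p : m ℕ.< p) → P (fromℕ< m<p)
    from-ℕ zero    0<p = subst P (toℕ-injective (trans toℕ-0# (sym (toℕ-fromℕ< 0<p)))) P0
    from-ℕ (suc m) m+1<p = subst P (toℕ-injective (begin
        toℕ (fromℕ< m<p ⊕ 1#)                 ≡⟨ toℕ-⊕ (fromℕ< m<p) 1# ⟩
        (toℕ (fromℕ< m<p) ℕ.+ toℕ 1#) % p     ≡⟨ cong₂ (λ k l → (k ℕ.+ l) % p) (toℕ-fromℕ< m<p) (toℕ-fromℕ< _) ⟩
        (m ℕ.+ 1 % p) % p                     ≡⟨ %-absorbʳ m 1 ⟩
        (m ℕ.+ 1) % p                         ≡⟨ cong (_% p) (ℕ.+-comm m 1) ⟩
        suc m % p                             ≡⟨ m<n⇒m%n≡m m+1<p ⟩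
        suc m                                 ≡⟨ toℕ-fromℕ< m+1<p ⟨
        toℕ (fromℕ< m+1<p)                    ∎))
      (Psuc _ (from-ℕ m m<p))
      where
      m<p : m ℕ.< p
      m<p = ℕ.<-trans (ℕ.n<1+n m) m+1<p

parity : ∀ {m} → (Fin m → Bool) → Bool
parity = foldr _xor_ false

parity-cong : ∀ {m} (f g : Fin m → Bool) → (∀ j → f j ≡ g j) → parity f ≡ parity g
parity-cong {zero}  f g f≗g = refl
parity-cong {suc m} f g f≗g = cong₂ _xor_ (f≗g Fin.zero) (parity-cong (f ∘ Fin.suc) (g ∘ Fin.suc) (f≗g ∘ Fin.suc))

parity-toggle : ∀ {m} (f g : Fin m → Bool) q → (∀ j → j ≢ q → f j ≡ g j) → f q ≡ not (g q) →
                parity f ≡ not (parity g)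
parity-toggle {suc m} f g Fin.zero f≗g fq = begin
  f Fin.zero xor parity (f ∘ Fin.suc)
    ≡⟨ cong₂ _xor_ fq (parity-cong (f ∘ Fin.suc) (g ∘ Fin.suc) (λ j → f≗g (Fin.suc j) λ ())) ⟩
  not (g Fin.zero) xor parity (g ∘ Fin.suc)    ≡⟨ not-distribˡ-xor (g Fin.zero) _ ⟨
  not (g Fin.zero xor parity (g ∘ Fin.suc))    ∎
parity-toggle {suc m} f g (Fin.suc q) f≗g fq = begin
  f Fin.zero xor parity (f ∘ Fin.suc)
    ≡⟨ cong₂ _xor_ (f≗g Fin.zero λ ())
         (parity-toggle (f ∘ Fin.suc) (g ∘ Fin.suc) q (λ j j≢q → f≗g (Fin.suc j) (j≢q ∘ suc-injective)) fq) ⟩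
  g Fin.zero xor not (parity (g ∘ Fin.suc))    ≡⟨ not-distribʳ-xor (g Fin.zero) _ ⟨
  not (g Fin.zero xor parity (g ∘ Fin.suc))    ∎

parity-false : ∀ m → parity {m} (λ _ → false) ≡ false
parity-false zero    = refl
parity-false (suc m) = parity-false m

parity-true≡false⇒even : ∀ m → parity {m} (λ _ → true) ≡ false → 2 ∣ m
parity-true≡false⇒even zero          _    = 2 ∣0
parity-true≡false⇒even (suc zero)    ()
parity-true≡false⇒even (suc (suc m)) even =
  ∣m∣n⇒∣m+n ∣-refl (parity-true≡false⇒even m (trans (sym (not-involutive _)) even))

-- The wreath product Zₚ ≀ Zₚ

module WreathProduct (p : ℕ) .{{_ : NonZero p}} where

  open ModularArithmetic p public
  open IsAbelianGroup ⊕-isAbelianGroup public using ()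
    renaming (assoc to ⊕-assoc; comm to ⊕-comm; identityˡ to ⊕-identityˡ; identityʳ to ⊕-identityʳ;
              inverseˡ to ⊕-inverseˡ; inverseʳ to ⊕-inverseʳ)
  open AbelianGroupProperties ⊕-abelianGroup public using ()
    renaming (⁻¹-involutive to ⊖-involutive; ε⁻¹≈ε to ⊖0#≡0#; ⁻¹-injective to ⊖-injective;
              ⁻¹-∙-comm to ⊖-distrib-⊕; x∙y⁻¹≈ε⇒x≈y to x⊖y≡0#⇒x≡y)

  infixl 6 _⊖_
  _⊖_ : Fin p → Fin p → Fin p
  a ⊖ b = a ⊕ ⊖ b

  ⊖-zero : ∀ {x} → x ≡ 0# → ⊖ x ≡ 0#
  ⊖-zero x≡0 = trans (cong ⊖_ x≡0) ⊖0#≡0#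

  ⊖-⊕-cancel : ∀ x a → x ⊖ a ⊕ a ≡ x
  ⊖-⊕-cancel x a = trans (⊕-assoc x (⊖ a) a) (trans (cong (x ⊕_) (⊕-inverseˡ a)) (⊕-identityʳ x))

  ⊕-⊖-cancel : ∀ x a → x ⊕ a ⊖ a ≡ x
  ⊕-⊖-cancel x a = trans (⊕-assoc x a (⊖ a)) (trans (cong (x ⊕_) (⊕-inverseʳ a)) (⊕-identityʳ x))

  ⊖-⊕-adjoint : ∀ {x a q} → x ⊖ a ≡ q ⇔ x ≡ q ⊕ a
  ⊖-⊕-adjoint {x} {a} = mk⇔ (λ { refl → sym (⊖-⊕-cancel x a) }) (λ { refl → ⊕-⊖-cancel _ a })

  open CommutativeSemigroupProperties (AbelianGroup.commutativeSemigroup ⊕-abelianGroup) public using ()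
    renaming (xy∙z≈xz∙y to ⊕-swapʳ)

  V : Set
  V = Vec (Fin p) p

  infixl 6 _+ᵛ_
  _+ᵛ_ : V → V → V
  _+ᵛ_ = vadd p

  -ᵛ_ : V → V
  -ᵛ_ = vneg p

  0ᵛ : V
  0ᵛ = vzero p

  rotate : Fin p → V → V
  rotate = rot p

  ≗⇒≡ : ∀ {v w : V} → (∀ i → lookup v i ≡ lookup w i) → v ≡ w
  ≗⇒≡ {v} {w} v≗w = trans (sym (tabulate∘lookup v)) (trans (tabulate-cong v≗w) (tabulate∘lookup w))

  lookup-+ᵛ : ∀ v w i → lookup (v +ᵛ w) i ≡ lookup v i ⊕ lookup w i
  lookup-+ᵛ v w = lookup∘tabulate _

  lookup--ᵛ : ∀ v i → lookup (-ᵛ v) i ≡ ⊖ lookup v i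
  lookup--ᵛ v = lookup∘tabulate _

  lookup-0ᵛ : ∀ i → lookup 0ᵛ i ≡ 0#
  lookup-0ᵛ = lookup∘tabulate _

  lookup-rotate : ∀ a v i → lookup (rotate a v) i ≡ lookup v (i ⊖ a)
  lookup-rotate a v = lookup∘tabulate _

  +ᵛ-isAbelianGroup : IsAbelianGroup _≡_ _+ᵛ_ 0ᵛ -ᵛ_
  +ᵛ-isAbelianGroup = record
    { isGroup = isGroup-≡ assoc identityˡ identityʳ inverseˡ inverseʳ
    ; comm    = comm
    }
    where
    assoc : ∀ u v w → (u +ᵛ v) +ᵛ w ≡ u +ᵛ (v +ᵛ w)
    assoc u v w = ≗⇒≡ λ i → begin
      lookup ((u +ᵛ v) +ᵛ w) i                   ≡⟨ lookup-+ᵛ (u +ᵛ v) w i ⟩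
      lookup (u +ᵛ v) i ⊕ lookup w i             ≡⟨ cong (_⊕ lookup w i) (lookup-+ᵛ u v i) ⟩
      lookup u i ⊕ lookup v i ⊕ lookup w i       ≡⟨ ⊕-assoc (lookup u i) (lookup v i) (lookup w i) ⟩
      lookup u i ⊕ (lookup v i ⊕ lookup w i)     ≡⟨ cong (lookup u i ⊕_) (lookup-+ᵛ v w i) ⟨
      lookup u i ⊕ lookup (v +ᵛ w) i             ≡⟨ lookup-+ᵛ u (v +ᵛ w) i ⟨
      lookup (u +ᵛ (v +ᵛ w)) i                   ∎
    comm : ∀ v w → v +ᵛ w ≡ w +ᵛ v
    comm v w = ≗⇒≡ λ i → begin
      lookup (v +ᵛ w) i          ≡⟨ lookup-+ᵛ v w i ⟩
      lookup v i ⊕ lookup w i    ≡⟨ ⊕-comm (lookup v i) (lookup w i) ⟩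
      lookup w i ⊕ lookup v i    ≡⟨ lookup-+ᵛ w v i ⟨
      lookup (w +ᵛ v) i          ∎
    identityˡ : ∀ v → 0ᵛ +ᵛ v ≡ v
    identityˡ v = ≗⇒≡ λ i → begin
      lookup (0ᵛ +ᵛ v) i         ≡⟨ lookup-+ᵛ 0ᵛ v i ⟩
      lookup 0ᵛ i ⊕ lookup v i   ≡⟨ cong (_⊕ lookup v i) (lookup-0ᵛ i) ⟩
      0# ⊕ lookup v i            ≡⟨ ⊕-identityˡ (lookup v i) ⟩
      lookup v i                 ∎
    identityʳ : ∀ v → v +ᵛ 0ᵛ ≡ v
    identityʳ v = trans (comm v 0ᵛ) (identityˡ v)
    inverseˡ : ∀ v → (-ᵛ v) +ᵛ v ≡ 0ᵛ
    inverseˡ v = ≗⇒≡ λ i → begin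
      lookup ((-ᵛ v) +ᵛ v) i          ≡⟨ lookup-+ᵛ (-ᵛ v) v i ⟩
      lookup (-ᵛ v) i ⊕ lookup v i    ≡⟨ cong (_⊕ lookup v i) (lookup--ᵛ v i) ⟩
      ⊖ lookup v i ⊕ lookup v i       ≡⟨ ⊕-inverseˡ (lookup v i) ⟩
      0#                              ≡⟨ lookup-0ᵛ i ⟨
      lookup 0ᵛ i                     ∎
    inverseʳ : ∀ v → v +ᵛ (-ᵛ v) ≡ 0ᵛ
    inverseʳ v = trans (comm v (-ᵛ v)) (inverseˡ v)

  +ᵛ-abelianGroup : AbelianGroup _ _
  +ᵛ-abelianGroup = record { isAbelianGroup = +ᵛ-isAbelianGroup }

  open IsAbelianGroup +ᵛ-isAbelianGroup public using ()
    renaming (comm to +ᵛ-comm; identityˡ to +ᵛ-identityˡ; identityʳ to +ᵛ-identityʳ)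
  open AbelianGroupProperties +ᵛ-abelianGroup public using ()
    renaming (⁻¹-involutive to -ᵛ-involutive; ε⁻¹≈ε to -ᵛ0ᵛ≡0ᵛ; ∙-cancelˡ to +ᵛ-cancelˡ;
              ⁻¹-∙-comm to -ᵛ-distrib-+ᵛ)

  open CommutativeSemigroupProperties (AbelianGroup.commutativeSemigroup +ᵛ-abelianGroup) public using ()
    renaming (xy∙z≈xz∙y to +ᵛ-swapʳ)

  rotate-+ᵛ : ∀ a v w → rotate a (v +ᵛ w) ≡ rotate a v +ᵛ rotate a w
  rotate-+ᵛ a v w = ≗⇒≡ λ i → begin
    lookup (rotate a (v +ᵛ w)) i                     ≡⟨ lookup-rotate a (v +ᵛ w) i ⟩
    lookup (v +ᵛ w) (i ⊖ a)                          ≡⟨ lookup-+ᵛ v w (i ⊖ a) ⟩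
    lookup v (i ⊖ a) ⊕ lookup w (i ⊖ a)              ≡⟨ cong₂ _⊕_ (lookup-rotate a v i) (lookup-rotate a w i) ⟨
    lookup (rotate a v) i ⊕ lookup (rotate a w) i    ≡⟨ lookup-+ᵛ (rotate a v) (rotate a w) i ⟨
    lookup (rotate a v +ᵛ rotate a w) i              ∎

  rotate-0# : ∀ v → rotate 0# v ≡ v
  rotate-0# v = ≗⇒≡ λ i → begin
    lookup (rotate 0# v) i    ≡⟨ lookup-rotate 0# v i ⟩
    lookup v (i ⊖ 0#)         ≡⟨ cong (λ j → lookup v (i ⊕ j)) ⊖0#≡0# ⟩
    lookup v (i ⊕ 0#)         ≡⟨ cong (lookup v) (⊕-identityʳ i) ⟩
    lookup v i                ∎

  rotate-rotate : ∀ a b v → rotate a (rotate b v) ≡ rotate (a ⊕ b) v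
  rotate-rotate a b v = ≗⇒≡ λ i → begin
    lookup (rotate a (rotate b v)) i    ≡⟨ lookup-rotate a (rotate b v) i ⟩
    lookup (rotate b v) (i ⊖ a)         ≡⟨ lookup-rotate b v (i ⊖ a) ⟩
    lookup v (i ⊖ a ⊖ b)                ≡⟨ cong (lookup v) (⊕-assoc i (⊖ a) (⊖ b)) ⟩
    lookup v (i ⊕ (⊖ a ⊕ ⊖ b))          ≡⟨ cong (λ j → lookup v (i ⊕ j)) (⊖-distrib-⊕ a b) ⟩
    lookup v (i ⊖ (a ⊕ b))              ≡⟨ lookup-rotate (a ⊕ b) v i ⟨
    lookup (rotate (a ⊕ b) v) i         ∎

  module Semidirect = SemidirectProduct (IsAbelianGroup.isGroup ⊕-isAbelianGroup)
    (IsAbelianGroup.isGroup +ᵛ-isAbelianGroup) rotate rotate-+ᵛ rotate-0# rotate-rotate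
  open Semidirect public using (_∙_; ε; _⁻¹)

  C : Set
  C = Fin p × V

  wreath-isGroup : IsGroup _≡_ (GroupData._∙_ (WreathData p)) (GroupData.ε (WreathData p)) (GroupData._⁻¹ (WreathData p))
  wreath-isGroup = Semidirect.isGroup

  wreath : Group _ _
  wreath = record { isGroup = wreath-isGroup }

  open GroupProperties wreath public using (∙-cancelʳ; ⁻¹-involutive)
  open IsGroup wreath-isGroup public using ()
    renaming (assoc to ∙-assoc; identityˡ to ∙-identityˡ; identityʳ to ∙-identityʳ)

  rotate-0ᵛ : ∀ a → rotate a 0ᵛ ≡ 0ᵛ
  rotate-0ᵛ = Semidirect.θ-zero

  rotate--ᵛ : ∀ a v → rotate a (-ᵛ v) ≡ -ᵛ rotate a v
  rotate--ᵛ = Semidirect.θ-inverse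

  -ᵛrotate-inverse : ∀ a u → -ᵛ rotate a (-ᵛ rotate (⊖ a) u) ≡ u
  -ᵛrotate-inverse a u = begin
    -ᵛ rotate a (-ᵛ rotate (⊖ a) u)      ≡⟨ cong -ᵛ_ (rotate--ᵛ a (rotate (⊖ a) u)) ⟩
    -ᵛ -ᵛ rotate a (rotate (⊖ a) u)      ≡⟨ -ᵛ-involutive _ ⟩
    rotate a (rotate (⊖ a) u)            ≡⟨ rotate-rotate a (⊖ a) u ⟩
    rotate (a ⊕ ⊖ a) u                   ≡⟨ cong (λ b → rotate b u) (⊕-inverseʳ a) ⟩
    rotate 0# u                          ≡⟨ rotate-0# u ⟩
    u                                    ∎

  N∙ : ∀ v b w → (0# , v) ∙ (b , w) ≡ (b , v +ᵛ w)
  N∙ v b w = cong₂ _,_ (⊕-identityˡ b) (cong (v +ᵛ_) (rotate-0# w))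

  ∙N : ∀ a v w → (a , v) ∙ (0# , w) ≡ (a , v +ᵛ rotate a w)
  ∙N a v w = cong (_, v +ᵛ rotate a w) (⊕-identityʳ a)

  N⁻¹ : ∀ v → (0# , v) ⁻¹ ≡ (0# , -ᵛ v)
  N⁻¹ v = cong₂ _,_ ⊖0#≡0# (cong -ᵛ_ (trans (cong (λ a → rotate a v) ⊖0#≡0#) (rotate-0# v)))

  N∙rotation : ∀ a v → (0# , v) ∙ (a , 0ᵛ) ≡ (a , v)
  N∙rotation a v = trans (N∙ v a 0ᵛ) (cong (a ,_) (+ᵛ-identityʳ v))

  N-comm : ∀ v w → (0# , v) ∙ (0# , w) ≡ (0# , w) ∙ (0# , v)
  N-comm v w = begin
    (0# , v) ∙ (0# , w)   ≡⟨ N∙ v 0# w ⟩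
    (0# , v +ᵛ w)         ≡⟨ cong (0# ,_) (+ᵛ-comm v w) ⟩
    (0# , w +ᵛ v)         ≡⟨ N∙ w 0# v ⟨
    (0# , w) ∙ (0# , v)   ∎

  conjugate-∈N : ∀ y v → proj₁ (y ∙ (0# , v) ∙ y ⁻¹) ≡ 0#
  conjugate-∈N (b , _) v = trans (cong (_⊕ ⊖ b) (⊕-identityʳ b)) (⊕-inverseʳ b)

  commutes-with-N⇒rotate-invariant : ∀ a u d → (a , u) ∙ (0# , d) ≡ (0# , d) ∙ (a , u) → rotate a d ≡ d
  commutes-with-N⇒rotate-invariant a u d comm = +ᵛ-cancelˡ u (rotate a d) d (begin
    u +ᵛ rotate a d    ≡⟨ cong proj₂ (∙N a u d) ⟨
    proj₂ ((a , u) ∙ (0# , d))   ≡⟨ cong proj₂ comm ⟩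
    proj₂ ((0# , d) ∙ (a , u))   ≡⟨ cong proj₂ (N∙ d a u) ⟩
    d +ᵛ u             ≡⟨ +ᵛ-comm d u ⟩
    u +ᵛ d             ∎)

  negateN : C → C
  negateN (a , v) = (a , -ᵛ v)

  negateN-involutive : ∀ x → negateN (negateN x) ≡ x
  negateN-involutive (a , v) = cong (a ,_) (-ᵛ-involutive v)

  negateN-homo : ∀ x y → negateN (x ∙ y) ≡ negateN x ∙ negateN y
  negateN-homo (a , v) (b , w) = cong (a ⊕ b ,_) (begin
    -ᵛ (v +ᵛ rotate a w)          ≡⟨ -ᵛ-distrib-+ᵛ v (rotate a w) ⟨
    -ᵛ v +ᵛ -ᵛ rotate a w         ≡⟨ cong (-ᵛ v +ᵛ_) (rotate--ᵛ a w) ⟨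
    -ᵛ v +ᵛ rotate a (-ᵛ w)       ∎)

  δ : Fin p → V
  δ q = tabulate λ j → if does (j ≟ q) then 1# else 0#

  lookup-δ : ∀ q j → lookup (δ q) j ≡ (if does (j ≟ q) then 1# else 0#)
  lookup-δ q = lookup∘tabulate _

  rotate-δ : ∀ a q → rotate a (δ q) ≡ δ (q ⊕ a)
  rotate-δ a q = ≗⇒≡ λ j → begin
    lookup (rotate a (δ q)) j                      ≡⟨ lookup-rotate a (δ q) j ⟩
    lookup (δ q) (j ⊖ a)                           ≡⟨ lookup-δ q (j ⊖ a) ⟩
    (if does (j ⊖ a ≟ q) then 1# else 0#)         ≡⟨ cong (if_then 1# else 0#) (does-⇔ ⊖-⊕-adjoint (j ⊖ a ≟ q) (j ≟ q ⊕ a)) ⟩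
    (if does (j ≟ q ⊕ a) then 1# else 0#)         ≡⟨ lookup-δ (q ⊕ a) j ⟨
    lookup (δ (q ⊕ a)) j                           ∎

  update-+ᵛ-δ : ∀ v q c → (v [ q ]≔ c) +ᵛ δ q ≡ v [ q ]≔ (c ⊕ 1#)
  update-+ᵛ-δ v q c = ≗⇒≡ λ j → trans (lookup-+ᵛ (v [ q ]≔ c) (δ q) j) (coordinate j)
    where
    coordinate : ∀ j → lookup (v [ q ]≔ c) j ⊕ lookup (δ q) j ≡ lookup (v [ q ]≔ (c ⊕ 1#)) j
    coordinate j rewrite lookup-δ q j with j ≟ q
    ... | yes refl = trans (cong (_⊕ 1#) (lookup∘update j v c)) (sym (lookup∘update j v (c ⊕ 1#)))
    ... | no j≢q = begin
      lookup (v [ q ]≔ c) j ⊕ 0#          ≡⟨ ⊕-identityʳ _ ⟩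
      lookup (v [ q ]≔ c) j               ≡⟨ lookup∘update′ j≢q v c ⟩
      lookup v j                          ≡⟨ lookup∘update′ j≢q v (c ⊕ 1#) ⟨
      lookup (v [ q ]≔ (c ⊕ 1#)) j        ∎

  +ᵛδ-induction : (P : V → Set) → P 0ᵛ → (∀ v q → P v → P (v +ᵛ δ q)) → ∀ v → P v
  +ᵛδ-induction P P0 P+δ v =
    vanishing-from p ℕ.≤-refl v (λ j p≤j → contradiction p≤j (ℕ.<⇒≱ (toℕ<n j)))
    where
    fill : ∀ v q → lookup v q ≡ 0# → P v → ∀ c → P (v [ q ]≔ c)
    fill v q vq≡0 Pv = ⊕1-induction (λ c → P (v [ q ]≔ c))
      (subst P (sym (trans (cong (v [ q ]≔_) (sym vq≡0)) ([]≔-lookup v q))) Pv)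
      (λ c Pc → subst P (update-+ᵛ-δ v q c) (P+δ _ q Pc))

    vanishing-from : ∀ k → k ℕ.≤ p → ∀ v → (∀ j → k ℕ.≤ toℕ j → lookup v j ≡ 0#) → P v
    vanishing-from zero _ v v≡0 = subst P (≗⇒≡ λ j → trans (lookup-0ᵛ j) (sym (v≡0 j ℕ.z≤n))) P0
    vanishing-from (suc k) k<p v vanishes =
      subst P restore (fill v₀ q (lookup∘update q v 0#) (vanishing-from k (ℕ.<⇒≤ k<p) v₀ v₀-vanishes) (lookup v q))
      where
      q : Fin p
      q = fromℕ< k<p
      v₀ : V
      v₀ = v [ q ]≔ 0#
      v₀-vanishes : ∀ j → k ℕ.≤ toℕ j → lookup v₀ j ≡ 0#
      v₀-vanishes j k≤j with j ≟ q
      ... | yes refl = lookup∘update q v 0#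
      ... | no j≢q = trans (lookup∘update′ j≢q v 0#) (vanishes j (ℕ.≤∧≢⇒< k≤j k≢j))
        where
        k≢j : k ≢ toℕ j
        k≢j k≡j = j≢q (toℕ-injective (trans (sym k≡j) (sym (toℕ-fromℕ< k<p))))
      restore : v₀ [ q ]≔ lookup v q ≡ v
      restore = trans ([]≔-idempotent v q) ([]≔-lookup v q)

  negateIf : Bool → Fin p → Fin p
  negateIf b x = if b then ⊖ x else x

  negateIf-preserves : ∀ {P : Fin p → Set} → (∀ {x} → P x → P (⊖ x)) → ∀ b {x} → P x → P (negateIf b x)
  negateIf-preserves P-⊖ true  = P-⊖
  negateIf-preserves P-⊖ false = λ Px → Px

  negateIf-involutive : ∀ b x → negateIf b (negateIf b x) ≡ x
  negateIf-involutive true  = ⊖-involutive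
  negateIf-involutive false = λ _ → refl

  negateIf-⊕ : ∀ b x y → negateIf b (x ⊕ y) ≡ negateIf b x ⊕ negateIf b y
  negateIf-⊕ true  x y = sym (⊖-distrib-⊕ x y)
  negateIf-⊕ false x y = refl

  negateIf-⊖ : ∀ b x → negateIf b (⊖ x) ≡ ⊖ negateIf b x
  negateIf-⊖ true  x = refl
  negateIf-⊖ false x = refl

  negateAt : Fin p → V → V
  negateAt q u = tabulate λ j → negateIf (does (j ≟ q)) (lookup u j)

  lookup-negateAt : ∀ q u j → lookup (negateAt q u) j ≡ negateIf (does (j ≟ q)) (lookup u j)
  lookup-negateAt q u = lookup∘tabulate _

  negateAt-preserves : ∀ {P : Fin p → Set} → (∀ {x} → P x → P (⊖ x)) →
                       ∀ q u j → P (lookup u j) → P (lookup (negateAt q u) j)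
  negateAt-preserves {P} P-⊖ q u j Puj =
    subst P (sym (lookup-negateAt q u j)) (negateIf-preserves {P} P-⊖ (does (j ≟ q)) Puj)

  negateAt-involutive : ∀ q u → negateAt q (negateAt q u) ≡ u
  negateAt-involutive q u = ≗⇒≡ λ j → begin
    lookup (negateAt q (negateAt q u)) j                    ≡⟨ lookup-negateAt q (negateAt q u) j ⟩
    negateIf (does (j ≟ q)) (lookup (negateAt q u) j)       ≡⟨ cong (negateIf _) (lookup-negateAt q u j) ⟩
    negateIf (does (j ≟ q)) (negateIf (does (j ≟ q)) _)     ≡⟨ negateIf-involutive (does (j ≟ q)) (lookup u j) ⟩
    lookup u j                                              ∎

  negateAt-comm : ∀ q r u → negateAt q (negateAt r u) ≡ negateAt r (negateAt q u)
  negateAt-comm q r u = ≗⇒≡ λ j → begin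
    lookup (negateAt q (negateAt r u)) j                          ≡⟨ lookup-negateAt q (negateAt r u) j ⟩
    negateIf (does (j ≟ q)) (lookup (negateAt r u) j)             ≡⟨ cong (negateIf _) (lookup-negateAt r u j) ⟩
    negateIf (does (j ≟ q)) (negateIf (does (j ≟ r)) (lookup u j)) ≡⟨ commute (does (j ≟ q)) (does (j ≟ r)) (lookup u j) ⟩
    negateIf (does (j ≟ r)) (negateIf (does (j ≟ q)) (lookup u j)) ≡⟨ cong (negateIf _) (lookup-negateAt q u j) ⟨
    negateIf (does (j ≟ r)) (lookup (negateAt q u) j)             ≡⟨ lookup-negateAt r (negateAt q u) j ⟨
    lookup (negateAt r (negateAt q u)) j                          ∎
    where
    commute : ∀ b c x → negateIf b (negateIf c x) ≡ negateIf c (negateIf b x)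
    commute true  true  x = refl
    commute true  false x = refl
    commute false c     x = refl

  negateAt-+ᵛ : ∀ q v w → negateAt q (v +ᵛ w) ≡ negateAt q v +ᵛ negateAt q w
  negateAt-+ᵛ q v w = ≗⇒≡ λ j → begin
    lookup (negateAt q (v +ᵛ w)) j                                 ≡⟨ lookup-negateAt q (v +ᵛ w) j ⟩
    negateIf (does (j ≟ q)) (lookup (v +ᵛ w) j)                    ≡⟨ cong (negateIf _) (lookup-+ᵛ v w j) ⟩
    negateIf (does (j ≟ q)) (lookup v j ⊕ lookup w j)              ≡⟨ negateIf-⊕ (does (j ≟ q)) (lookup v j) (lookup w j) ⟩
    negateIf (does (j ≟ q)) (lookup v j) ⊕ negateIf (does (j ≟ q)) (lookup w j)
      ≡⟨ cong₂ _⊕_ (lookup-negateAt q v j) (lookup-negateAt q w j) ⟨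
    lookup (negateAt q v) j ⊕ lookup (negateAt q w) j              ≡⟨ lookup-+ᵛ (negateAt q v) (negateAt q w) j ⟨
    lookup (negateAt q v +ᵛ negateAt q w) j                        ∎

  negateAt--ᵛ : ∀ q v → negateAt q (-ᵛ v) ≡ -ᵛ negateAt q v
  negateAt--ᵛ q v = ≗⇒≡ λ j → begin
    lookup (negateAt q (-ᵛ v)) j                   ≡⟨ lookup-negateAt q (-ᵛ v) j ⟩
    negateIf (does (j ≟ q)) (lookup (-ᵛ v) j)      ≡⟨ cong (negateIf _) (lookup--ᵛ v j) ⟩
    negateIf (does (j ≟ q)) (⊖ lookup v j)         ≡⟨ negateIf-⊖ (does (j ≟ q)) (lookup v j) ⟩
    ⊖ negateIf (does (j ≟ q)) (lookup v j)         ≡⟨ cong ⊖_ (lookup-negateAt q v j) ⟨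
    ⊖ lookup (negateAt q v) j                      ≡⟨ lookup--ᵛ (negateAt q v) j ⟨
    lookup (-ᵛ negateAt q v) j                     ∎

  rotate-negateAt : ∀ a q v → rotate a (negateAt q v) ≡ negateAt (q ⊕ a) (rotate a v)
  rotate-negateAt a q v = ≗⇒≡ λ j → begin
    lookup (rotate a (negateAt q v)) j                      ≡⟨ lookup-rotate a (negateAt q v) j ⟩
    lookup (negateAt q v) (j ⊖ a)                           ≡⟨ lookup-negateAt q v (j ⊖ a) ⟩
    negateIf (does (j ⊖ a ≟ q)) (lookup v (j ⊖ a))
      ≡⟨ cong₂ negateIf (does-⇔ ⊖-⊕-adjoint (j ⊖ a ≟ q) (j ≟ q ⊕ a)) (sym (lookup-rotate a v j)) ⟩
    negateIf (does (j ≟ q ⊕ a)) (lookup (rotate a v) j)     ≡⟨ lookup-negateAt (q ⊕ a) (rotate a v) j ⟨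
    lookup (negateAt (q ⊕ a) (rotate a v)) j                ∎

  lookup-δ-same : ∀ q → lookup (δ q) q ≡ 1#
  lookup-δ-same q = trans (lookup-δ q q) (cong (if_then 1# else 0#) (dec-true (q ≟ q) refl))

  lookup-δ-other : ∀ {q j} → j ≢ q → lookup (δ q) j ≡ 0#
  lookup-δ-other {q} {j} j≢q = trans (lookup-δ q j) (cong (if_then 1# else 0#) (dec-false (j ≟ q) j≢q))

  lookup-+ᵛ-zeroˡ : ∀ v w j → lookup v j ≡ 0# → lookup (v +ᵛ w) j ≡ lookup w j
  lookup-+ᵛ-zeroˡ v w j vj≡0 = trans (lookup-+ᵛ v w j) (trans (cong (_⊕ lookup w j) vj≡0) (⊕-identityˡ _))

  lookup-+ᵛ-zeroʳ : ∀ v w j → lookup w j ≡ 0# → lookup (v +ᵛ w) j ≡ lookup v j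
  lookup-+ᵛ-zeroʳ v w j wj≡0 = trans (lookup-+ᵛ v w j) (trans (cong (lookup v j ⊕_) wj≡0) (⊕-identityʳ _))

  lookup--ᵛrotate : ∀ a u j → lookup (-ᵛ rotate a u) (j ⊕ a) ≡ ⊖ lookup u j
  lookup--ᵛrotate a u j = begin
    lookup (-ᵛ rotate a u) (j ⊕ a)     ≡⟨ lookup--ᵛ (rotate a u) (j ⊕ a) ⟩
    ⊖ lookup (rotate a u) (j ⊕ a)      ≡⟨ cong ⊖_ (lookup-rotate a u (j ⊕ a)) ⟩
    ⊖ lookup u (j ⊕ a ⊖ a)             ≡⟨ cong (λ i → ⊖ lookup u i) (⊕-⊖-cancel j a) ⟩
    ⊖ lookup u j                       ∎

  lookup-via--ᵛrotate : ∀ a u j → lookup u j ≡ ⊖ lookup (-ᵛ rotate a u) (j ⊕ a)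
  lookup-via--ᵛrotate a u j = trans (sym (⊖-involutive (lookup u j))) (cong ⊖_ (sym (lookup--ᵛrotate a u j)))

  δ₀ : V
  δ₀ = δ 0#

  t e : C
  t = (1# , 0ᵛ)
  e = (0# , δ₀)

  fixes-t-and-e⇒identity : (f : C → C) → (∀ x y → f (x ∙ y) ≡ f x ∙ f y) →
                           f t ≡ t → f e ≡ e → ∀ g → f g ≡ g
  fixes-t-and-e⇒identity f homo ft fe (a , v) = begin
      f (a , v)                   ≡⟨ cong f (N∙rotation a v) ⟨
      f ((0# , v) ∙ (a , 0ᵛ))     ≡⟨ homo (0# , v) (a , 0ᵛ) ⟩
      f (0# , v) ∙ f (a , 0ᵛ)     ≡⟨ cong₂ _∙_ (fixes-N v) (fixes-rotation a) ⟩
      (0# , v) ∙ (a , 0ᵛ)         ≡⟨ N∙rotation a v ⟩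
      (a , v)                     ∎
    where
    open HomomorphismProperties wreath-isGroup wreath-isGroup f homo

    fixes-rotation : ∀ a → f (a , 0ᵛ) ≡ (a , 0ᵛ)
    fixes-rotation = ⊕1-induction _ ε-homo λ a fa → begin
      f (a ⊕ 1# , 0ᵛ)     ≡⟨ cong f (∙t a) ⟨
      f ((a , 0ᵛ) ∙ t)     ≡⟨ homo (a , 0ᵛ) t ⟩
      f (a , 0ᵛ) ∙ f t     ≡⟨ cong₂ _∙_ fa ft ⟩
      (a , 0ᵛ) ∙ t         ≡⟨ ∙t a ⟩
      (a ⊕ 1# , 0ᵛ)       ∎
      where
      ∙t : ∀ a → (a , 0ᵛ) ∙ t ≡ (a ⊕ 1# , 0ᵛ)
      ∙t a = cong (a ⊕ 1# ,_) (trans (+ᵛ-identityˡ _) (rotate-0ᵛ a))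

    fixes-δ : ∀ q → f (0# , δ q) ≡ (0# , δ q)
    fixes-δ q = ∙-cancelʳ (q , 0ᵛ) (f (0# , δ q)) (0# , δ q) (begin
      f (0# , δ q) ∙ (q , 0ᵛ)       ≡⟨ cong (f (0# , δ q) ∙_) (fixes-rotation q) ⟨
      f (0# , δ q) ∙ f (q , 0ᵛ)     ≡⟨ homo _ _ ⟨
      f ((0# , δ q) ∙ (q , 0ᵛ))     ≡⟨ cong f conjugate ⟩
      f ((q , 0ᵛ) ∙ e)              ≡⟨ homo _ _ ⟩
      f (q , 0ᵛ) ∙ f e              ≡⟨ cong₂ _∙_ (fixes-rotation q) fe ⟩
      (q , 0ᵛ) ∙ e                  ≡⟨ conjugate ⟨
      (0# , δ q) ∙ (q , 0ᵛ)         ∎)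
      where
      conjugate : (0# , δ q) ∙ (q , 0ᵛ) ≡ (q , 0ᵛ) ∙ e
      conjugate = begin
        (0# , δ q) ∙ (q , 0ᵛ)        ≡⟨ N∙rotation q (δ q) ⟩
        (q , δ q)                    ≡⟨ cong (λ r → (q , δ r)) (⊕-identityˡ q) ⟨
        (q , δ (0# ⊕ q))             ≡⟨ cong (q ,_) (rotate-δ q 0#) ⟨
        (q , rotate q δ₀)            ≡⟨ cong (q ,_) (+ᵛ-identityˡ _) ⟨
        (q , 0ᵛ +ᵛ rotate q δ₀)      ≡⟨ ∙N q 0ᵛ δ₀ ⟨
        (q , 0ᵛ) ∙ e                 ∎

    fixes-N : ∀ v → f (0# , v) ≡ (0# , v)
    fixes-N = +ᵛδ-induction _ ε-homo λ v q fv → begin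
      f (0# , v +ᵛ δ q)            ≡⟨ cong f (N∙ v 0# (δ q)) ⟨
      f ((0# , v) ∙ (0# , δ q))     ≡⟨ homo _ _ ⟩
      f (0# , v) ∙ f (0# , δ q)     ≡⟨ cong₂ _∙_ fv (fixes-δ q) ⟩
      (0# , v) ∙ (0# , δ q)         ≡⟨ N∙ v 0# (δ q) ⟩
      (0# , v +ᵛ δ q)              ∎

-- The connection set S

module Counterexample (n : ℕ) where

  p : ℕ
  p = suc (suc (suc n))

  open WreathProduct p public

  -1# 2# : Fin p
  -1# = ⊖ 1#
  2# = 1# ⊕ 1#

  1#≢0# : 1# ≢ 0#
  1#≢0# ()

  -1#≢0# : -1# ≢ 0#
  -1#≢0# -1≡0 = 1#≢0# (⊖-injective (trans -1≡0 (sym ⊖0#≡0#)))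

  -1#≢1# : -1# ≢ 1#
  -1#≢1# -1≡1 with trans (cong (1# ⊕_) (sym -1≡1)) (⊕-inverseʳ 1#)
  ... | ()

  IsSign : Fin p → Set
  IsSign x = x ≡ 1# ⊎ x ≡ -1#

  IsSign? : ∀ x → Dec (IsSign x)
  IsSign? x = x ≟ 1# ⊎-dec x ≟ -1#

  IsSign⇒≢0# : ∀ {x} → IsSign x → x ≢ 0#
  IsSign⇒≢0# (inj₁ refl) = 1#≢0#
  IsSign⇒≢0# (inj₂ refl) = -1#≢0#

  IsSign-⊖ : ∀ {x} → IsSign x → IsSign (⊖ x)
  IsSign-⊖ (inj₁ refl) = inj₂ refl
  IsSign-⊖ (inj₂ refl) = inj₁ (⊖-involutive 1#)

  IsSign-unique-up-to-sign : ∀ {x y} → IsSign x → IsSign y → y ≡ x ⊎ y ≡ ⊖ x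
  IsSign-unique-up-to-sign (inj₁ refl) (inj₁ refl) = inj₁ refl
  IsSign-unique-up-to-sign (inj₁ refl) (inj₂ refl) = inj₂ refl
  IsSign-unique-up-to-sign (inj₂ refl) (inj₁ refl) = inj₂ (sym (⊖-involutive 1#))
  IsSign-unique-up-to-sign (inj₂ refl) (inj₂ refl) = inj₁ refl

  isNegative : Fin p → Bool
  isNegative x = does (x ≟ -1#)

  isNegative-1# : isNegative 1# ≡ false
  isNegative-1# = dec-false (1# ≟ -1#) (-1#≢1# ∘ sym)

  isNegative--1# : isNegative -1# ≡ true
  isNegative--1# = dec-true (-1# ≟ -1#) refl

  isNegative-⊖ : ∀ {x} → IsSign x → isNegative (⊖ x) ≡ not (isNegative x)
  isNegative-⊖ (inj₁ refl) = trans isNegative--1# (cong not (sym isNegative-1#))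
  isNegative-⊖ (inj₂ refl) =
    trans (cong isNegative (⊖-involutive 1#)) (trans isNegative-1# (cong not (sym isNegative--1#)))

  IsZero : V → Set
  IsZero u = ∀ j → lookup u j ≡ 0#

  IsSignedδ₀ : V → Set
  IsSignedδ₀ u = IsSign (lookup u 0#) × (∀ j → j ≢ 0# → lookup u j ≡ 0#)

  IsSignVector : V → Set
  IsSignVector u = ∀ j → IsSign (lookup u j)

  negativeParity : V → Bool
  negativeParity u = parity λ j → isNegative (lookup u j)

  δ₀-signed : IsSignedδ₀ δ₀
  δ₀-signed = inj₁ (lookup-δ-same 0#) , λ j → lookup-δ-other

  IsSignedδ₀--ᵛ : ∀ w → IsSignedδ₀ w → IsSignedδ₀ (-ᵛ w)
  IsSignedδ₀--ᵛ w (sign , off-0) =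
    subst IsSign (sym (lookup--ᵛ w 0#)) (IsSign-⊖ sign) ,
    λ j j≢0 → trans (lookup--ᵛ w j) (⊖-zero (off-0 j j≢0))

  IsZero? : ∀ u → Dec (IsZero u)
  IsZero? u = all? λ j → lookup u j ≟ 0#

  IsSignedδ₀? : ∀ u → Dec (IsSignedδ₀ u)
  IsSignedδ₀? u = IsSign? (lookup u 0#) ×-dec all? λ j → ¬? (j ≟ 0#) →-dec lookup u j ≟ 0#

  data InS₁ (u : V) : Set where
    zero-vector : IsZero u → InS₁ u
    signed-δ₀   : IsSignedδ₀ u → InS₁ u
    even-signs  : IsSignVector u → negativeParity u ≡ false → InS₁ u

  -- Since (-1 , u)⁻¹ = (1 , -ᵛ rotate 1# u), the slice over -1 is the inverse of the slice over 1.
  data InS (g : C) : Set where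
    over-0#   : proj₁ g ≡ 0# → IsSignedδ₀ (proj₂ g) → InS g
    over-1#   : proj₁ g ≡ 1# → InS₁ (proj₂ g) → InS g
    over--1#  : proj₁ g ≡ -1# → InS₁ (-ᵛ rotate 1# (proj₂ g)) → InS g
    elsewhere : proj₁ g ≢ 0# → proj₁ g ≢ 1# → proj₁ g ≢ -1# → IsZero (proj₂ g) → InS g

  InS₁? : ∀ u → Dec (InS₁ u)
  InS₁? u = map′ fromSum toSum
    (IsZero? u ⊎-dec IsSignedδ₀? u ⊎-dec (all? (λ j → IsSign? (lookup u j)) ×-dec negativeParity u Bool.≟ false))
    where
    fromSum : IsZero u ⊎ IsSignedδ₀ u ⊎ (IsSignVector u × negativeParity u ≡ false) → InS₁ u
    fromSum (inj₁ u≡0)                   = zero-vector u≡0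
    fromSum (inj₂ (inj₁ u∈S₀))           = signed-δ₀ u∈S₀
    fromSum (inj₂ (inj₂ (signs , even))) = even-signs signs even
    toSum : InS₁ u → IsZero u ⊎ IsSignedδ₀ u ⊎ (IsSignVector u × negativeParity u ≡ false)
    toSum (zero-vector u≡0)      = inj₁ u≡0
    toSum (signed-δ₀ u∈S₀)       = inj₂ (inj₁ u∈S₀)
    toSum (even-signs signs even) = inj₂ (inj₂ (signs , even))

  InS? : ∀ g → Dec (InS g)
  InS? (c , u) = map′ fromSum toSum
    ((c ≟ 0# ×-dec IsSignedδ₀? u) ⊎-dec (c ≟ 1# ×-dec InS₁? u) ⊎-dec (c ≟ -1# ×-dec InS₁? (-ᵛ rotate 1# u))
      ⊎-dec (¬? (c ≟ 0#) ×-dec ¬? (c ≟ 1#) ×-dec ¬? (c ≟ -1#) ×-dec IsZero? u))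
    where
    Slices : Set
    Slices = (c ≡ 0# × IsSignedδ₀ u) ⊎ (c ≡ 1# × InS₁ u) ⊎ (c ≡ -1# × InS₁ (-ᵛ rotate 1# u))
           ⊎ (c ≢ 0# × c ≢ 1# × c ≢ -1# × IsZero u)
    fromSum : Slices → InS (c , u)
    fromSum (inj₁ (c≡0 , u∈S₀))                           = over-0# c≡0 u∈S₀
    fromSum (inj₂ (inj₁ (c≡1 , u∈S₁)))                    = over-1# c≡1 u∈S₁
    fromSum (inj₂ (inj₂ (inj₁ (c≡-1 , u∈S₋₁))))           = over--1# c≡-1 u∈S₋₁
    fromSum (inj₂ (inj₂ (inj₂ (c≢0 , c≢1 , c≢-1 , u≡0)))) = elsewhere c≢0 c≢1 c≢-1 u≡0
    toSum : InS (c , u) → Slices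
    toSum (over-0# c≡0 u∈S₀)              = inj₁ (c≡0 , u∈S₀)
    toSum (over-1# c≡1 u∈S₁)              = inj₂ (inj₁ (c≡1 , u∈S₁))
    toSum (over--1# c≡-1 u∈S₋₁)           = inj₂ (inj₂ (inj₁ (c≡-1 , u∈S₋₁)))
    toSum (elsewhere c≢0 c≢1 c≢-1 u≡0)    = inj₂ (inj₂ (inj₂ (c≢0 , c≢1 , c≢-1 , u≡0)))

  S : Subset (WreathData p)
  S g = does (InS? g)

  InS⇔⇒S≡ : ∀ g h → (InS g ⇔ InS h) → S g ≡ S h
  InS⇔⇒S≡ g h g⇔h = does-⇔ g⇔h (InS? g) (InS? h)

  InS-0# : ∀ {u} → InS (0# , u) → IsSignedδ₀ u
  InS-0# (over-0# _ u∈S₀)     = u∈S₀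
  InS-0# (over-1# 0≡1 _)      = contradiction (sym 0≡1) 1#≢0#
  InS-0# (over--1# 0≡-1 _)    = contradiction (sym 0≡-1) -1#≢0#
  InS-0# (elsewhere 0≢0 _ _ _) = contradiction refl 0≢0

  InS-1# : ∀ {u} → InS (1# , u) → InS₁ u
  InS-1# (over-0# 1≡0 _)       = contradiction 1≡0 1#≢0#
  InS-1# (over-1# _ u∈S₁)      = u∈S₁
  InS-1# (over--1# 1≡-1 _)     = contradiction (sym 1≡-1) -1#≢1#
  InS-1# (elsewhere _ 1≢1 _ _) = contradiction refl 1≢1

  InS--1# : ∀ {u} → InS (-1# , u) → InS₁ (-ᵛ rotate 1# u)
  InS--1# (over-0# -1≡0 _)       = contradiction -1≡0 -1#≢0#
  InS--1# (over-1# -1≡1 _)       = contradiction -1≡1 -1#≢1#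
  InS--1# (over--1# _ u∈S₋₁)     = u∈S₋₁
  InS--1# (elsewhere _ _ -1≢-1 _) = contradiction refl -1≢-1

  InS-elsewhere : ∀ {c u} → c ≢ 0# → c ≢ 1# → c ≢ -1# → InS (c , u) → IsZero u
  InS-elsewhere c≢0 _   _    (over-0# c≡0 _)    = contradiction c≡0 c≢0
  InS-elsewhere _   c≢1 _    (over-1# c≡1 _)    = contradiction c≡1 c≢1
  InS-elsewhere _   _   c≢-1 (over--1# c≡-1 _)  = contradiction c≡-1 c≢-1
  InS-elsewhere _   _   _    (elsewhere _ _ _ u≡0) = u≡0

  InS-zero : ∀ c → c ≢ 0# → InS (c , 0ᵛ)
  InS-zero c c≢0 = by-cases (c ≟ 1#) (c ≟ -1#)
    where
    -ᵛrotate-0ᵛ : IsZero (-ᵛ rotate 1# 0ᵛ)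
    -ᵛrotate-0ᵛ j = trans (cong (λ v → lookup v j) (trans (cong -ᵛ_ (rotate-0ᵛ 1#)) -ᵛ0ᵛ≡0ᵛ)) (lookup-0ᵛ j)
    by-cases : Dec (c ≡ 1#) → Dec (c ≡ -1#) → InS (c , 0ᵛ)
    by-cases (yes c≡1) _          = over-1# c≡1 (zero-vector lookup-0ᵛ)
    by-cases (no _)    (yes c≡-1) = over--1# c≡-1 (zero-vector -ᵛrotate-0ᵛ)
    by-cases (no c≢1)  (no c≢-1)  = elsewhere c≢0 c≢1 c≢-1 lookup-0ᵛ

  InS-⁻¹ : ∀ g → InS g → InS (g ⁻¹)
  InS-⁻¹ (c , u) (over-0# refl u∈S₀) =
    over-0# ⊖0#≡0# (subst IsSignedδ₀ (sym -ᵛrotate-⊖0#) (IsSignedδ₀--ᵛ u u∈S₀))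
    where
    -ᵛrotate-⊖0# : -ᵛ rotate (⊖ 0#) u ≡ -ᵛ u
    -ᵛrotate-⊖0# = cong -ᵛ_ (trans (cong (λ a → rotate a u) ⊖0#≡0#) (rotate-0# u))
  InS-⁻¹ (c , u) (over-1# refl u∈S₁) = over--1# refl (subst InS₁ (sym (-ᵛrotate-inverse 1# u)) u∈S₁)
  InS-⁻¹ (c , u) (over--1# refl u∈S₋₁) =
    over-1# (⊖-involutive 1#) (subst InS₁ (cong (λ a → -ᵛ rotate a u) (sym (⊖-involutive 1#))) u∈S₋₁)
  InS-⁻¹ (c , u) (elsewhere c≢0 c≢1 c≢-1 u≡0) = elsewhere ⊖c≢0 ⊖c≢1 ⊖c≢-1 λ j → begin
    lookup (-ᵛ rotate (⊖ c) u) j     ≡⟨ lookup--ᵛ (rotate (⊖ c) u) j ⟩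
    ⊖ lookup (rotate (⊖ c) u) j      ≡⟨ cong ⊖_ (trans (lookup-rotate (⊖ c) u j) (u≡0 _)) ⟩
    ⊖ 0#                             ≡⟨ ⊖0#≡0# ⟩
    0#                               ∎
    where
    ⊖c≢0 : ⊖ c ≢ 0#
    ⊖c≢0 ⊖c≡0 = c≢0 (⊖-injective (trans ⊖c≡0 (sym ⊖0#≡0#)))
    ⊖c≢1 : ⊖ c ≢ 1#
    ⊖c≢1 ⊖c≡1 = c≢-1 (trans (sym (⊖-involutive c)) (cong ⊖_ ⊖c≡1))
    ⊖c≢-1 : ⊖ c ≢ -1#
    ⊖c≢-1 ⊖c≡-1 = c≢1 (⊖-injective ⊖c≡-1)

  S-inverse-closed : InverseClosed (WreathData p) S
  S-inverse-closed g = InS⇔⇒S≡ (g ⁻¹) g (involution-invariant InS _⁻¹ ⁻¹-involutive InS-⁻¹ g)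

  -- Cay(G , S) is not a DRR

  flip : Fin p → V → V
  flip a = negateAt a ∘ negateAt (a ⊕ 1#)

  flip-involutive : ∀ a u → flip a (flip a u) ≡ u
  flip-involutive a u = begin
    negateAt a (negateAt (a ⊕ 1#) (negateAt a (negateAt (a ⊕ 1#) u)))
      ≡⟨ cong (negateAt a) (negateAt-comm (a ⊕ 1#) a (negateAt (a ⊕ 1#) u)) ⟩
    negateAt a (negateAt a (negateAt (a ⊕ 1#) (negateAt (a ⊕ 1#) u)))
      ≡⟨ negateAt-involutive a (negateAt (a ⊕ 1#) (negateAt (a ⊕ 1#) u)) ⟩
    negateAt (a ⊕ 1#) (negateAt (a ⊕ 1#) u)
      ≡⟨ negateAt-involutive (a ⊕ 1#) u ⟩
    u ∎

  flip-+ᵛ : ∀ a v w → flip a (v +ᵛ w) ≡ flip a v +ᵛ flip a w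
  flip-+ᵛ a v w = trans (cong (negateAt a) (negateAt-+ᵛ (a ⊕ 1#) v w))
                        (negateAt-+ᵛ a (negateAt (a ⊕ 1#) v) (negateAt (a ⊕ 1#) w))

  flip--ᵛ : ∀ a v → flip a (-ᵛ v) ≡ -ᵛ flip a v
  flip--ᵛ a v = trans (cong (negateAt a) (negateAt--ᵛ (a ⊕ 1#) v)) (negateAt--ᵛ a (negateAt (a ⊕ 1#) v))

  rotate-flip : ∀ c a v → rotate c (flip a v) ≡ flip (a ⊕ c) (rotate c v)
  rotate-flip c a v = begin
    rotate c (negateAt a (negateAt (a ⊕ 1#) v))                 ≡⟨ rotate-negateAt c a (negateAt (a ⊕ 1#) v) ⟩
    negateAt (a ⊕ c) (rotate c (negateAt (a ⊕ 1#) v))           ≡⟨ cong (negateAt (a ⊕ c)) (rotate-negateAt c (a ⊕ 1#) v) ⟩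
    negateAt (a ⊕ c) (negateAt (a ⊕ 1# ⊕ c) (rotate c v))
      ≡⟨ cong (λ b → negateAt (a ⊕ c) (negateAt b (rotate c v))) (⊕-swapʳ a 1# c) ⟩
    negateAt (a ⊕ c) (negateAt (a ⊕ c ⊕ 1#) (rotate c v))       ∎

  IsZero-negateAt : ∀ q u → IsZero u → IsZero (negateAt q u)
  IsZero-negateAt q u u≡0 j = negateAt-preserves {_≡ 0#} ⊖-zero q u j (u≡0 j)

  IsSignedδ₀-negateAt : ∀ q u → IsSignedδ₀ u → IsSignedδ₀ (negateAt q u)
  IsSignedδ₀-negateAt q u (sign , off-0) =
    negateAt-preserves {IsSign} IsSign-⊖ q u 0# sign ,
    λ j j≢0 → negateAt-preserves {_≡ 0#} ⊖-zero q u j (off-0 j j≢0)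

  IsSignVector-negateAt : ∀ q u → IsSignVector u → IsSignVector (negateAt q u)
  IsSignVector-negateAt q u signs j = negateAt-preserves {IsSign} IsSign-⊖ q u j (signs j)

  IsZero-flip : ∀ a u → IsZero u → IsZero (flip a u)
  IsZero-flip a u u≡0 = IsZero-negateAt a (negateAt (a ⊕ 1#) u) (IsZero-negateAt (a ⊕ 1#) u u≡0)

  IsSignedδ₀-flip : ∀ a u → IsSignedδ₀ u → IsSignedδ₀ (flip a u)
  IsSignedδ₀-flip a u u∈S₀ = IsSignedδ₀-negateAt a (negateAt (a ⊕ 1#) u) (IsSignedδ₀-negateAt (a ⊕ 1#) u u∈S₀)

  negativeParity-negateAt : ∀ q u → IsSignVector u → negativeParity (negateAt q u) ≡ not (negativeParity u)
  negativeParity-negateAt q u signs =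
    parity-toggle (λ j → isNegative (lookup (negateAt q u) j)) (λ j → isNegative (lookup u j)) q unchanged toggled
    where
    unchanged : ∀ j → j ≢ q → isNegative (lookup (negateAt q u) j) ≡ isNegative (lookup u j)
    unchanged j j≢q = cong isNegative
      (trans (lookup-negateAt q u j) (cong (λ b → negateIf b (lookup u j)) (dec-false (j ≟ q) j≢q)))
    toggled : isNegative (lookup (negateAt q u) q) ≡ not (isNegative (lookup u q))
    toggled = begin
      isNegative (lookup (negateAt q u) q)                 ≡⟨ cong isNegative (lookup-negateAt q u q) ⟩
      isNegative (negateIf (does (q ≟ q)) (lookup u q))
        ≡⟨ cong (λ b → isNegative (negateIf b (lookup u q))) (dec-true (q ≟ q) refl) ⟩
      isNegative (⊖ lookup u q)                            ≡⟨ isNegative-⊖ (signs q) ⟩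
      not (isNegative (lookup u q))                        ∎

  InS₁-flip : ∀ a u → InS₁ u → InS₁ (flip a u)
  InS₁-flip a u (zero-vector u≡0)       = zero-vector (IsZero-flip a u u≡0)
  InS₁-flip a u (signed-δ₀ u∈S₀)        = signed-δ₀ (IsSignedδ₀-flip a u u∈S₀)
  InS₁-flip a u (even-signs signs even) = even-signs (IsSignVector-negateAt a u′ signs′) (begin
    negativeParity (negateAt a u′)     ≡⟨ negativeParity-negateAt a u′ signs′ ⟩
    not (negativeParity u′)            ≡⟨ cong not (negativeParity-negateAt (a ⊕ 1#) u signs) ⟩
    not (not (negativeParity u))       ≡⟨ not-involutive _ ⟩
    negativeParity u                   ≡⟨ even ⟩
    false                              ∎)
    where
    u′ : V
    u′ = negateAt (a ⊕ 1#) u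
    signs′ : IsSignVector u′
    signs′ = IsSignVector-negateAt (a ⊕ 1#) u signs

  InS-flip : ∀ c a u → InS (c , u) → InS (c , flip a u)
  InS-flip c a u (over-0# c≡0 u∈S₀)  = over-0# c≡0 (IsSignedδ₀-flip a u u∈S₀)
  InS-flip c a u (over-1# c≡1 u∈S₁) = over-1# c≡1 (InS₁-flip a u u∈S₁)
  InS-flip c a u (over--1# c≡-1 u∈S₋₁) =
    over--1# c≡-1 (subst InS₁ (sym inverted-flip) (InS₁-flip (a ⊕ 1#) (-ᵛ rotate 1# u) u∈S₋₁))
    where
    inverted-flip : -ᵛ rotate 1# (flip a u) ≡ flip (a ⊕ 1#) (-ᵛ rotate 1# u)
    inverted-flip = trans (cong -ᵛ_ (rotate-flip 1# a u)) (sym (flip--ᵛ (a ⊕ 1#) (rotate 1# u)))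
  InS-flip c a u (elsewhere c≢0 c≢1 c≢-1 u≡0) = elsewhere c≢0 c≢1 c≢-1 (IsZero-flip a u u≡0)

  σ : C → C
  σ (a , v) = (a , flip a v)

  σ-involutive : ∀ x → σ (σ x) ≡ x
  σ-involutive (a , v) = cong (a ,_) (flip-involutive a v)

  σ-difference : ∀ a v b w → σ (b , w) ∙ σ (a , v) ⁻¹ ≡ (b ⊕ ⊖ a , flip b (w +ᵛ rotate b (-ᵛ rotate (⊖ a) v)))
  σ-difference a v b w = cong (b ⊕ ⊖ a ,_) (begin
    flip b w +ᵛ rotate b (-ᵛ rotate (⊖ a) (flip a v))
      ≡⟨ cong (λ z → flip b w +ᵛ rotate b (-ᵛ z)) (rotate-flip (⊖ a) a v) ⟩
    flip b w +ᵛ rotate b (-ᵛ flip (a ⊕ ⊖ a) (rotate (⊖ a) v))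
      ≡⟨ cong (λ c → flip b w +ᵛ rotate b (-ᵛ flip c (rotate (⊖ a) v))) (⊕-inverseʳ a) ⟩
    flip b w +ᵛ rotate b (-ᵛ flip 0# (rotate (⊖ a) v))
      ≡⟨ cong (λ z → flip b w +ᵛ rotate b z) (flip--ᵛ 0# (rotate (⊖ a) v)) ⟨
    flip b w +ᵛ rotate b (flip 0# (-ᵛ rotate (⊖ a) v))
      ≡⟨ cong (flip b w +ᵛ_) (rotate-flip b 0# (-ᵛ rotate (⊖ a) v)) ⟩
    flip b w +ᵛ flip (0# ⊕ b) (rotate b (-ᵛ rotate (⊖ a) v))
      ≡⟨ cong (λ c → flip b w +ᵛ flip c (rotate b (-ᵛ rotate (⊖ a) v))) (⊕-identityˡ b) ⟩
    flip b w +ᵛ flip b (rotate b (-ᵛ rotate (⊖ a) v))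
      ≡⟨ flip-+ᵛ b w (rotate b (-ᵛ rotate (⊖ a) v)) ⟨
    flip b (w +ᵛ rotate b (-ᵛ rotate (⊖ a) v))
      ∎)

  σ-preserves-arcs : ∀ x y → S (σ y ∙ σ x ⁻¹) ≡ S (y ∙ x ⁻¹)
  σ-preserves-arcs (a , v) (b , w) = InS⇔⇒S≡ (σ (b , w) ∙ σ (a , v) ⁻¹) ((b , w) ∙ (a , v) ⁻¹)
    (subst (λ z → InS z ⇔ InS ((b , w) ∙ (a , v) ⁻¹)) (sym (σ-difference a v b w))
      (involution-invariant (λ u → InS (b ⊕ ⊖ a , u)) (flip b) (flip-involutive b) (InS-flip (b ⊕ ⊖ a) b)
        (w +ᵛ rotate b (-ᵛ rotate (⊖ a) v))))

  σ-automorphism : CayAut (WreathData p) S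
  σ-automorphism = record
    { perm = record { to = σ ; from = σ ; to-from = σ-involutive ; from-to = σ-involutive }
    ; arcs = σ-preserves-arcs
    }

  S-not-DRR : ¬ IsDRR (WreathData p) S
  S-not-DRR drr = -1#≢1# (begin
    -1#                     ≡⟨⟩
    lookup (flip 0# δ₀) 0#  ≡⟨ cong (λ x → lookup (proj₂ x) 0#) σe≡e ⟩
    lookup δ₀ 0#            ≡⟨ lookup-δ-same 0# ⟩
    1#                      ∎)
    where
    h : C
    h = proj₁ (drr σ-automorphism)
    σ≡∙h : ∀ g → σ g ≡ g ∙ h
    σ≡∙h = proj₂ (drr σ-automorphism)
    h≡ε : h ≡ ε
    h≡ε = begin
      h          ≡⟨ ∙-identityˡ h ⟨
      ε ∙ h      ≡⟨ σ≡∙h ε ⟨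
      σ ε        ≡⟨ cong (0# ,_) (≗⇒≡ λ j → trans (IsZero-flip 0# 0ᵛ lookup-0ᵛ j) (sym (lookup-0ᵛ j))) ⟩
      ε          ∎
    σe≡e : σ e ≡ e
    σe≡e = trans (σ≡∙h e) (trans (cong (e ∙_) h≡ε) (∙-identityʳ e))

  -- Aut(G , S) is trivial

  Sparse : V → Set
  Sparse u = ∃ λ q → ∀ j → j ≢ q → lookup u j ≡ 0#

  Full : V → Set
  Full u = ∀ j → lookup u j ≢ 0#

  Sparse⇒nonzeros-coincide : ∀ {u j l} → Sparse u → lookup u j ≢ 0# → lookup u l ≢ 0# → j ≡ l
  Sparse⇒nonzeros-coincide {u} (q , off-q) uj≢0 ul≢0 = trans (at-q uj≢0) (sym (at-q ul≢0))
    where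
    at-q : ∀ {i} → lookup u i ≢ 0# → i ≡ q
    at-q {i} ui≢0 = decidable-stable (i ≟ q) (λ i≢q → ui≢0 (off-q i i≢q))

  InS₁⇒Sparse⊎Full : ∀ {u} → InS₁ u → Sparse u ⊎ Full u
  InS₁⇒Sparse⊎Full (zero-vector u≡0)      = inj₁ (0# , λ j _ → u≡0 j)
  InS₁⇒Sparse⊎Full (signed-δ₀ (_ , off-0)) = inj₁ (0# , off-0)
  InS₁⇒Sparse⊎Full (even-signs signs _)    = inj₂ λ j → IsSign⇒≢0# (signs j)

  Sparse-from--ᵛrotate : ∀ a u → Sparse (-ᵛ rotate a u) → Sparse u
  Sparse-from--ᵛrotate a u (q , off-q) = q ⊖ a , λ j j≢q⊖a → begin
    lookup u j                             ≡⟨ lookup-via--ᵛrotate a u j ⟩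
    ⊖ lookup (-ᵛ rotate a u) (j ⊕ a)
      ≡⟨ cong ⊖_ (off-q (j ⊕ a) (λ j⊕a≡q → j≢q⊖a (trans (sym (⊕-⊖-cancel j a)) (cong (_⊖ a) j⊕a≡q)))) ⟩
    ⊖ 0#                                   ≡⟨ ⊖0#≡0# ⟩
    0#                                     ∎

  Full-from--ᵛrotate : ∀ a u → Full (-ᵛ rotate a u) → Full u
  Full-from--ᵛrotate a u full j uj≡0 =
    full (j ⊕ a) (trans (lookup--ᵛrotate a u j) (⊖-zero uj≡0))

  InS⇒Sparse⊎Full : ∀ c u → InS (c , u) → Sparse u ⊎ Full u
  InS⇒Sparse⊎Full c u (over-0# _ (_ , off-0))  = inj₁ (0# , off-0)
  InS⇒Sparse⊎Full c u (over-1# _ u∈S₁)         = InS₁⇒Sparse⊎Full u∈S₁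
  InS⇒Sparse⊎Full c u (over--1# _ u∈S₋₁)       =
    Sum.map (Sparse-from--ᵛrotate 1# u) (Full-from--ᵛrotate 1# u) (InS₁⇒Sparse⊎Full u∈S₋₁)
  InS⇒Sparse⊎Full c u (elsewhere _ _ _ u≡0)    = inj₁ (0# , λ j _ → u≡0 j)

  InS⇒Full : ∀ c u {j l} → InS (c , u) → lookup u j ≢ 0# → lookup u l ≢ 0# → j ≢ l → Full u
  InS⇒Full c u u∈S uj≢0 ul≢0 j≢l =
    Sum.[ (λ sparse → contradiction (Sparse⇒nonzeros-coincide {u} sparse uj≢0 ul≢0) j≢l) , (λ full → full) ]′
      (InS⇒Sparse⊎Full c u u∈S)

  InS₁-zero-at-0#⇒IsZero : ∀ {y} → InS₁ y → lookup y 0# ≡ 0# → IsZero y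
  InS₁-zero-at-0#⇒IsZero (zero-vector y≡0)       _    = y≡0
  InS₁-zero-at-0#⇒IsZero (signed-δ₀ (sign , _))   y0≡0 = contradiction y0≡0 (IsSign⇒≢0# sign)
  InS₁-zero-at-0#⇒IsZero (even-signs signs _)     y0≡0 = contradiction y0≡0 (IsSign⇒≢0# (signs 0#))

  δ₀-cancelling-signs-∉S : ∀ k w u → IsSignedδ₀ w → IsSignVector u →
                           lookup (w +ᵛ u) 0# ≡ 0# → ¬ InS (k , w +ᵛ u)
  δ₀-cancelling-signs-∉S k w u (_ , off-0) signs cancels w+u∈S =
    InS⇒Full k (w +ᵛ u) {1#} {2#} w+u∈S (nonzero-off-0 {1#} (λ ())) (nonzero-off-0 {2#} (λ ())) (λ ()) 0# cancels
    where
    nonzero-off-0 : ∀ {j} → j ≢ 0# → lookup (w +ᵛ u) j ≢ 0#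
    nonzero-off-0 {j} j≢0 = IsSign⇒≢0# (signs j) ∘ trans (sym (lookup-+ᵛ-zeroˡ w u j (off-0 j j≢0)))

  sign-vector-excluded : ∀ k w u → IsSignedδ₀ w → IsSignVector u →
                         InS (k , w +ᵛ u) → InS (k , -ᵛ w +ᵛ u) → ⊥
  sign-vector-excluded k w u w∈S₀ signs w+u∈S -w+u∈S =
    by-cases (IsSign-unique-up-to-sign (proj₁ w∈S₀) (signs 0#))
    where
    by-cases : lookup u 0# ≡ lookup w 0# ⊎ lookup u 0# ≡ ⊖ lookup w 0# → ⊥
    by-cases (inj₁ u0≡w0)  = δ₀-cancelling-signs-∉S k (-ᵛ w) u (IsSignedδ₀--ᵛ w w∈S₀) signs (begin
      lookup (-ᵛ w +ᵛ u) 0#             ≡⟨ lookup-+ᵛ (-ᵛ w) u 0# ⟩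
      lookup (-ᵛ w) 0# ⊕ lookup u 0#    ≡⟨ cong₂ _⊕_ (lookup--ᵛ w 0#) u0≡w0 ⟩
      ⊖ lookup w 0# ⊕ lookup w 0#       ≡⟨ ⊕-inverseˡ (lookup w 0#) ⟩
      0#                                ∎) -w+u∈S
    by-cases (inj₂ u0≡-w0) = δ₀-cancelling-signs-∉S k w u w∈S₀ signs (begin
      lookup (w +ᵛ u) 0#                ≡⟨ lookup-+ᵛ w u 0# ⟩
      lookup w 0# ⊕ lookup u 0#         ≡⟨ cong (lookup w 0# ⊕_) u0≡-w0 ⟩
      lookup w 0# ⊕ ⊖ lookup w 0#       ≡⟨ ⊕-inverseʳ (lookup w 0#) ⟩
      0#                                ∎) w+u∈S

  image-of-t-over-1# : ∀ w u → IsSignedδ₀ w → InS₁ u → InS (1# , w +ᵛ u) → InS (1# , -ᵛ w +ᵛ u) →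
                       InS (2# , u +ᵛ rotate 1# u) → IsZero u
  image-of-t-over-1# w u _ (zero-vector u≡0) _ _ _ = u≡0
  image-of-t-over-1# w u _ (signed-δ₀ (sign , off-0)) _ _ t²∈S =
    ⊥-elim (InS⇒Full 2# x {0#} {1#} t²∈S x0≢0 x1≢0 (λ ()) 2# x2≡0)
    where
    x : V
    x = u +ᵛ rotate 1# u
    lookup-x : ∀ j → lookup x j ≡ lookup u j ⊕ lookup u (j ⊖ 1#)
    lookup-x j = trans (lookup-+ᵛ u (rotate 1# u) j) (cong (lookup u j ⊕_) (lookup-rotate 1# u j))
    x0≢0 : lookup x 0# ≢ 0#
    x0≢0 = IsSign⇒≢0# sign ∘ trans (sym (begin
      lookup x 0#                          ≡⟨ lookup-x 0# ⟩
      lookup u 0# ⊕ lookup u (0# ⊖ 1#)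
        ≡⟨ cong (lookup u 0# ⊕_) (off-0 (0# ⊖ 1#) (-1#≢0# ∘ trans (sym (⊕-identityˡ -1#)))) ⟩
      lookup u 0# ⊕ 0#                     ≡⟨ ⊕-identityʳ _ ⟩
      lookup u 0#                          ∎))
    x1≢0 : lookup x 1# ≢ 0#
    x1≢0 = IsSign⇒≢0# sign ∘ trans (sym (begin
      lookup x 1#                          ≡⟨ lookup-x 1# ⟩
      lookup u 1# ⊕ lookup u (1# ⊖ 1#)     ≡⟨ cong₂ _⊕_ (off-0 1# (λ ())) (cong (lookup u) (⊕-inverseʳ 1#)) ⟩
      0# ⊕ lookup u 0#                     ≡⟨ ⊕-identityˡ _ ⟩
      lookup u 0#                          ∎))
    x2≡0 : lookup x 2# ≡ 0#
    x2≡0 = begin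
      lookup x 2#                          ≡⟨ lookup-x 2# ⟩
      lookup u 2# ⊕ lookup u (2# ⊖ 1#)     ≡⟨ cong₂ _⊕_ (off-0 2# (λ ())) (cong (lookup u) (⊕-⊖-cancel 1# 1#)) ⟩
      0# ⊕ lookup u 1#                     ≡⟨ cong (0# ⊕_) (off-0 1# (λ ())) ⟩
      0# ⊕ 0#                              ≡⟨ ⊕-identityˡ 0# ⟩
      0#                                   ∎
  image-of-t-over-1# w u w∈S₀ (even-signs signs _) w+u∈S -w+u∈S _ =
    ⊥-elim (sign-vector-excluded 1# w u w∈S₀ signs w+u∈S -w+u∈S)

  image-of-t-not-over--1# : ∀ w u → IsSignedδ₀ w → InS₁ (-ᵛ rotate 1# u) →
                            InS (-1# , w +ᵛ u) → InS (-1# , -ᵛ w +ᵛ u) → ⊥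
  image-of-t-not-over--1# w u (w0-sign , w-off-0) (zero-vector u′≡0) w+u∈S _ =
    y1≢0 (InS₁-zero-at-0#⇒IsZero (InS--1# w+u∈S) y0≡0 1#)
    where
    u≡0 : IsZero u
    u≡0 j = trans (lookup-via--ᵛrotate 1# u j) (⊖-zero (u′≡0 (j ⊕ 1#)))
    y : V
    y = -ᵛ rotate 1# (w +ᵛ u)
    lookup-y : ∀ j → lookup y (j ⊕ 1#) ≡ ⊖ lookup w j
    lookup-y j = trans (lookup--ᵛrotate 1# (w +ᵛ u) j) (cong ⊖_ (lookup-+ᵛ-zeroʳ w u j (u≡0 j)))
    y0≡0 : lookup y 0# ≡ 0#
    y0≡0 = begin
      lookup y 0#            ≡⟨ cong (lookup y) (⊕-inverseˡ 1#) ⟨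
      lookup y (-1# ⊕ 1#)    ≡⟨ lookup-y -1# ⟩
      ⊖ lookup w -1#         ≡⟨ cong ⊖_ (w-off-0 -1# -1#≢0#) ⟩
      ⊖ 0#                   ≡⟨ ⊖0#≡0# ⟩
      0#                     ∎
    y1≢0 : lookup y 1# ≢ 0#
    y1≢0 = IsSign⇒≢0# (IsSign-⊖ w0-sign) ∘ trans (sym (lookup-y 0#))
  image-of-t-not-over--1# w u (w0-sign , w-off-0) (signed-δ₀ (u′0-sign , u′-off-0)) w+u∈S _ =
    InS⇒Full -1# (w +ᵛ u) {0#} { -1#} w+u∈S x0≢0 x-1≢0 (-1#≢0# ∘ sym) 1# x1≡0
    where
    lookup-u : ∀ j → lookup u j ≡ ⊖ lookup (-ᵛ rotate 1# u) (j ⊕ 1#)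
    lookup-u = lookup-via--ᵛrotate 1# u
    u-vanishes : ∀ j → j ⊕ 1# ≢ 0# → lookup u j ≡ 0#
    u-vanishes j j+1≢0 = trans (lookup-u j) (⊖-zero (u′-off-0 (j ⊕ 1#) j+1≢0))
    x0≢0 : lookup (w +ᵛ u) 0# ≢ 0#
    x0≢0 = IsSign⇒≢0# w0-sign ∘ trans (sym (lookup-+ᵛ-zeroʳ w u 0# (u-vanishes 0# (1#≢0# ∘ trans (sym (⊕-identityˡ 1#))))))
    x-1≢0 : lookup (w +ᵛ u) -1# ≢ 0#
    x-1≢0 = IsSign⇒≢0# (IsSign-⊖ u′0-sign) ∘ trans (sym (begin
      lookup (w +ᵛ u) -1#                          ≡⟨ lookup-+ᵛ-zeroˡ w u -1# (w-off-0 -1# -1#≢0#) ⟩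
      lookup u -1#                                 ≡⟨ lookup-u -1# ⟩
      ⊖ lookup (-ᵛ rotate 1# u) (-1# ⊕ 1#)         ≡⟨ cong (λ j → ⊖ lookup (-ᵛ rotate 1# u) j) (⊕-inverseˡ 1#) ⟩
      ⊖ lookup (-ᵛ rotate 1# u) 0#                 ∎))
    x1≡0 : lookup (w +ᵛ u) 1# ≡ 0#
    x1≡0 = trans (lookup-+ᵛ-zeroʳ w u 1# (u-vanishes 1# (λ ()))) (w-off-0 1# (λ ()))
  image-of-t-not-over--1# w u w∈S₀ (even-signs signs′ _) w+u∈S -w+u∈S =
    sign-vector-excluded -1# w u w∈S₀ signs w+u∈S -w+u∈S
    where
    signs : IsSignVector u
    signs j = subst IsSign (sym (lookup-via--ᵛrotate 1# u j)) (IsSign-⊖ (signs′ (j ⊕ 1#)))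

  S-pins-image-of-t : ∀ k w u → IsSignedδ₀ w → k ≢ 0# →
                      InS (k , u) → InS (k , w +ᵛ u) → InS (k , -ᵛ w +ᵛ u) → InS (k ⊕ k , u +ᵛ rotate k u) →
                      k ≡ 1# × IsZero u
  S-pins-image-of-t k w u w∈S₀ k≢0 u∈S w+u∈S -w+u∈S t²∈S = by-cases (k ≟ 1#) (k ≟ -1#)
    where
    over : ∀ {c} → k ≡ c → ∀ v → InS (k , v) → InS (c , v)
    over k≡c v = subst (λ c → InS (c , v)) k≡c

    by-cases : Dec (k ≡ 1#) → Dec (k ≡ -1#) → k ≡ 1# × IsZero u
    by-cases (yes k≡1) _ = k≡1 , image-of-t-over-1# w u w∈S₀ (InS-1# (over k≡1 u u∈S))
      (over k≡1 (w +ᵛ u) w+u∈S) (over k≡1 (-ᵛ w +ᵛ u) -w+u∈S) (subst (λ c → InS (c ⊕ c , u +ᵛ rotate c u)) k≡1 t²∈S)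
    by-cases (no _) (yes k≡-1) = ⊥-elim (image-of-t-not-over--1# w u w∈S₀ (InS--1# (over k≡-1 u u∈S))
      (over k≡-1 (w +ᵛ u) w+u∈S) (over k≡-1 (-ᵛ w +ᵛ u) -w+u∈S))
    by-cases (no k≢1) (no k≢-1) = ⊥-elim (IsSign⇒≢0# (proj₁ w∈S₀) (begin
      lookup w 0#           ≡⟨ lookup-+ᵛ-zeroʳ w u 0# (InS-elsewhere k≢0 k≢1 k≢-1 u∈S 0#) ⟨
      lookup (w +ᵛ u) 0#    ≡⟨ InS-elsewhere k≢0 k≢1 k≢-1 w+u∈S 0# ⟩
      0#                    ∎))

  e-conjugate : ∀ a u → e ∙ (a , u) ∙ e ⁻¹ ≡ (0# , δ₀ +ᵛ rotate a (-ᵛ δ₀)) ∙ (a , u)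
  e-conjugate a u = begin
    e ∙ (a , u) ∙ e ⁻¹                      ≡⟨ cong₂ _∙_ (N∙ δ₀ a u) (N⁻¹ δ₀) ⟩
    (a , δ₀ +ᵛ u) ∙ (0# , -ᵛ δ₀)            ≡⟨ ∙N a (δ₀ +ᵛ u) (-ᵛ δ₀) ⟩
    (a , δ₀ +ᵛ u +ᵛ rotate a (-ᵛ δ₀))       ≡⟨ cong (a ,_) (+ᵛ-swapʳ δ₀ u (rotate a (-ᵛ δ₀))) ⟩
    (a , δ₀ +ᵛ rotate a (-ᵛ δ₀) +ᵛ u)       ≡⟨ N∙ (δ₀ +ᵛ rotate a (-ᵛ δ₀)) a u ⟨
    (0# , δ₀ +ᵛ rotate a (-ᵛ δ₀)) ∙ (a , u) ∎

  -- e x e⁻¹ = (0 , δ₀ - δₐ) x for x = (a , u), so if x commutes with it, rotation by a fixes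
  -- δ₀ - δₐ; at coordinate a this reads 1 = -1 unless a = 0.
  commutes-with-e-conjugate⇒∈N : ∀ x → x ∙ (e ∙ x ∙ e ⁻¹) ≡ (e ∙ x ∙ e ⁻¹) ∙ x → proj₁ x ≡ 0#
  commutes-with-e-conjugate⇒∈N (a , u) comm = decidable-stable (a ≟ 0#) λ a≢0 →
    -1#≢1# (sym (begin
      1#                        ≡⟨ d-at-0 a≢0 ⟨
      lookup d 0#               ≡⟨ cong (lookup d) (⊕-inverseʳ a) ⟨
      lookup d (a ⊖ a)          ≡⟨ lookup-rotate a d a ⟨
      lookup (rotate a d) a     ≡⟨ cong (λ v → lookup v a) d-invariant ⟩
      lookup d a                ≡⟨ d-at-a a≢0 ⟩
      -1#                       ∎))
    where
    x : C
    x = (a , u)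
    d : V
    d = δ₀ +ᵛ rotate a (-ᵛ δ₀)

    lookup-d : ∀ j → lookup d j ≡ lookup δ₀ j ⊕ ⊖ lookup δ₀ (j ⊖ a)
    lookup-d j = trans (lookup-+ᵛ δ₀ (rotate a (-ᵛ δ₀)) j)
      (cong (lookup δ₀ j ⊕_) (trans (lookup-rotate a (-ᵛ δ₀) j) (lookup--ᵛ δ₀ (j ⊖ a))))

    d-at-0 : a ≢ 0# → lookup d 0# ≡ 1#
    d-at-0 a≢0 = begin
      lookup d 0#                               ≡⟨ lookup-d 0# ⟩
      lookup δ₀ 0# ⊕ ⊖ lookup δ₀ (0# ⊖ a)
        ≡⟨ cong₂ (λ y z → y ⊕ ⊖ z) (lookup-δ-same 0#) (lookup-δ-other (a≢0 ∘ sym ∘ x⊖y≡0#⇒x≡y 0# a)) ⟩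
      1# ⊕ ⊖ 0#                                 ≡⟨ cong (1# ⊕_) ⊖0#≡0# ⟩
      1# ⊕ 0#                                   ≡⟨ ⊕-identityʳ 1# ⟩
      1#                                        ∎

    d-at-a : a ≢ 0# → lookup d a ≡ -1#
    d-at-a a≢0 = begin
      lookup d a                                ≡⟨ lookup-d a ⟩
      lookup δ₀ a ⊕ ⊖ lookup δ₀ (a ⊖ a)
        ≡⟨ cong₂ (λ y z → y ⊕ ⊖ z) (lookup-δ-other a≢0) (trans (cong (lookup δ₀) (⊕-inverseʳ a)) (lookup-δ-same 0#)) ⟩
      0# ⊕ -1#                                  ≡⟨ ⊕-identityˡ -1# ⟩
      -1#                                       ∎

    d-invariant : rotate a d ≡ d
    d-invariant = commutes-with-N⇒rotate-invariant a u d (∙-cancelʳ x (x ∙ (0# , d)) ((0# , d) ∙ x) (begin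
      x ∙ (0# , d) ∙ x            ≡⟨ ∙-assoc x (0# , d) x ⟩
      x ∙ ((0# , d) ∙ x)          ≡⟨ cong (x ∙_) (e-conjugate a u) ⟨
      x ∙ (e ∙ x ∙ e ⁻¹)          ≡⟨ comm ⟩
      (e ∙ x ∙ e ⁻¹) ∙ x          ≡⟨ cong (_∙ x) (e-conjugate a u) ⟩
      (0# , d) ∙ x ∙ x            ∎))

  t∙e≢e∙t : t ∙ e ≢ e ∙ t
  t∙e≢e∙t comm = 1#≢0# (begin
    1#                          ≡⟨ lookup-δ-same 1# ⟨
    lookup (δ 1#) 1#            ≡⟨ cong (λ q → lookup (δ q) 1#) (⊕-identityˡ 1#) ⟨
    lookup (δ (0# ⊕ 1#)) 1#     ≡⟨ cong (λ v → lookup v 1#) (rotate-δ 1# 0#) ⟨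
    lookup (rotate 1# δ₀) 1#    ≡⟨ cong (λ v → lookup v 1#) (commutes-with-N⇒rotate-invariant 1# 0ᵛ δ₀ comm) ⟩
    lookup δ₀ 1#                ≡⟨ lookup-δ-other {0#} {1#} (λ ()) ⟩
    0#                          ∎)

  supported-at-0#-≡ : ∀ {v w} → lookup v 0# ≡ lookup w 0# →
                      (∀ j → j ≢ 0# → lookup v j ≡ 0#) → (∀ j → j ≢ 0# → lookup w j ≡ 0#) → v ≡ w
  supported-at-0#-≡ {v} {w} v0≡w0 v-off-0 w-off-0 = ≗⇒≡ λ j → agree j (j ≟ 0#)
    where
    agree : ∀ j → Dec (j ≡ 0#) → lookup v j ≡ lookup w j
    agree j (yes refl) = v0≡w0
    agree j (no j≢0)   = trans (v-off-0 j j≢0) (sym (w-off-0 j j≢0))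

  IsSignedδ₀⇒±δ₀ : ∀ w → IsSignedδ₀ w → w ≡ δ₀ ⊎ w ≡ -ᵛ δ₀
  IsSignedδ₀⇒±δ₀ w (inj₁ w0≡1 , off-0) =
    inj₁ (supported-at-0#-≡ (trans w0≡1 (sym (lookup-δ-same 0#))) off-0 (proj₂ δ₀-signed))
  IsSignedδ₀⇒±δ₀ w (inj₂ w0≡-1 , off-0) =
    inj₂ (supported-at-0#-≡ (trans w0≡-1 (sym -δ₀-at-0)) off-0 (proj₂ (IsSignedδ₀--ᵛ δ₀ δ₀-signed)))
    where
    -δ₀-at-0 : lookup (-ᵛ δ₀) 0# ≡ -1#
    -δ₀-at-0 = trans (lookup--ᵛ δ₀ 0#) (cong ⊖_ (lookup-δ-same 0#))

  ones : V
  ones = replicate p 1#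

  ones∈S₁ : InS₁ ones
  ones∈S₁ = even-signs (λ j → inj₁ (lookup-replicate j 1#)) (begin
    negativeParity ones
      ≡⟨ parity-cong (λ j → isNegative (lookup ones j)) (λ _ → false)
           (λ j → trans (cong isNegative (lookup-replicate j 1#)) isNegative-1#) ⟩
    parity {p} (λ _ → false) ≡⟨ parity-false p ⟩
    false                  ∎)

  lookup--ones : ∀ j → lookup (-ᵛ ones) j ≡ -1#
  lookup--ones j = trans (lookup--ᵛ ones j) (cong ⊖_ (lookup-replicate j 1#))

  -ones∉S₁ : ¬ 2 ∣ p → ¬ InS₁ (-ᵛ ones)
  -ones∉S₁ odd (zero-vector is-zero)    = -1#≢0# (trans (sym (lookup--ones 0#)) (is-zero 0#))
  -ones∉S₁ odd (signed-δ₀ (_ , off-0))  = -1#≢0# (trans (sym (lookup--ones 1#)) (off-0 1# (λ ())))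
  -ones∉S₁ odd (even-signs _ even)      = odd (parity-true≡false⇒even p (begin
    parity {p} (λ _ → true)
      ≡⟨ parity-cong (λ _ → true) (λ j → isNegative (lookup (-ᵛ ones) j))
           (λ j → sym (trans (cong isNegative (lookup--ones j)) isNegative--1#)) ⟩
    negativeParity (-ᵛ ones)  ≡⟨ even ⟩
    false                     ∎))

  module AutomorphismPreservingS (odd : ¬ 2 ∣ p) (φ : GroupAut (WreathData p))
                                 (preserves-S : ∀ g → S (GroupAut.to φ g) ≡ S g) where

    open GroupAut φ
    open HomomorphismProperties wreath-isGroup wreath-isGroup to hom

    image-∈S : ∀ x y → InS x → to x ≡ y → InS y
    image-∈S x y x∈S to-x≡y =
      subst InS to-x≡y (does≡true⇒ (InS? (to x)) (trans (preserves-S x) (dec-true (InS? x) x∈S)))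

    to-e∈N : proj₁ (to e) ≡ 0#
    to-e∈N = commutes-with-e-conjugate⇒∈N (to e) (begin
      to e ∙ (e ∙ to e ∙ e ⁻¹)     ≡⟨ cong (to e ∙_) to-k ⟨
      to e ∙ to k                  ≡⟨ hom e k ⟨
      to (e ∙ k)                   ≡⟨ cong to e∙k≡k∙e ⟩
      to (k ∙ e)                   ≡⟨ hom k e ⟩
      to k ∙ to e                  ≡⟨ cong (_∙ to e) to-k ⟩
      (e ∙ to e ∙ e ⁻¹) ∙ to e     ∎)
      where
      y k : C
      y = from e
      k = y ∙ e ∙ y ⁻¹
      to-k : to k ≡ e ∙ to e ∙ e ⁻¹
      to-k = begin
        to (y ∙ e ∙ y ⁻¹)           ≡⟨ hom (y ∙ e) (y ⁻¹) ⟩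
        to (y ∙ e) ∙ to (y ⁻¹)      ≡⟨ cong₂ _∙_ (hom y e) (⁻¹-homo y) ⟩
        to y ∙ to e ∙ to y ⁻¹       ≡⟨ cong (λ z → z ∙ to e ∙ z ⁻¹) (to-from e) ⟩
        e ∙ to e ∙ e ⁻¹             ∎
      e∙k≡k∙e : e ∙ k ≡ k ∙ e
      e∙k≡k∙e = subst (λ z → e ∙ z ≡ z ∙ e) (cong (_, proj₂ k) (sym (conjugate-∈N y δ₀))) (N-comm δ₀ (proj₂ k))

    w : V
    w = proj₂ (to e)

    to-e : to e ≡ (0# , w)
    to-e = cong (_, w) to-e∈N

    w∈S₀ : IsSignedδ₀ w
    w∈S₀ = InS-0# (image-∈S e (0# , w) (over-0# refl δ₀-signed) to-e)

    k : Fin p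
    k = proj₁ (to t)

    u : V
    u = proj₂ (to t)

    k≢0 : k ≢ 0#
    k≢0 k≡0 = t∙e≢e∙t (begin
      t ∙ e                     ≡⟨ from-to (t ∙ e) ⟨
      from (to (t ∙ e))         ≡⟨ cong from (hom t e) ⟩
      from (to t ∙ to e)        ≡⟨ cong from (begin
          to t ∙ to e               ≡⟨ cong₂ _∙_ to-t∈N to-e ⟩
          (0# , u) ∙ (0# , w)       ≡⟨ N-comm u w ⟩
          (0# , w) ∙ (0# , u)       ≡⟨ cong₂ _∙_ to-e to-t∈N ⟨
          to e ∙ to t               ∎) ⟩
      from (to e ∙ to t)        ≡⟨ cong from (hom e t) ⟨
      from (to (e ∙ t))         ≡⟨ from-to (e ∙ t) ⟩
      e ∙ t                     ∎)
      where
      to-t∈N : to t ≡ (0# , u)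
      to-t∈N = cong (_, u) k≡0

    t∈S : InS (k , u)
    t∈S = image-∈S t (k , u) (InS-zero 1# 1#≢0#) refl

    e∙t∈S : InS (k , w +ᵛ u)
    e∙t∈S = image-∈S (e ∙ t) (k , w +ᵛ u) (subst InS (sym (N∙rotation 1# δ₀)) (over-1# refl (signed-δ₀ δ₀-signed)))
      (trans (hom e t) (trans (cong (_∙ to t) to-e) (N∙ w k u)))

    e⁻¹∙t∈S : InS (k , -ᵛ w +ᵛ u)
    e⁻¹∙t∈S = image-∈S (e ⁻¹ ∙ t) (k , -ᵛ w +ᵛ u)
      (subst InS (sym e⁻¹∙t) (over-1# refl (signed-δ₀ (IsSignedδ₀--ᵛ δ₀ δ₀-signed))))
      (trans (hom (e ⁻¹) t) (trans (cong (_∙ to t) to-e⁻¹) (N∙ (-ᵛ w) k u)))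
      where
      e⁻¹∙t : e ⁻¹ ∙ t ≡ (1# , -ᵛ δ₀)
      e⁻¹∙t = trans (cong (_∙ t) (N⁻¹ δ₀)) (N∙rotation 1# (-ᵛ δ₀))
      to-e⁻¹ : to (e ⁻¹) ≡ (0# , -ᵛ w)
      to-e⁻¹ = trans (⁻¹-homo e) (trans (cong _⁻¹ to-e) (N⁻¹ w))

    t∙t∈S : InS (k ⊕ k , u +ᵛ rotate k u)
    t∙t∈S = image-∈S (t ∙ t) (k ⊕ k , u +ᵛ rotate k u) (subst InS (sym t∙t) (InS-zero 2# (λ ()))) (hom t t)
      where
      t∙t : t ∙ t ≡ (2# , 0ᵛ)
      t∙t = cong (2# ,_) (trans (+ᵛ-identityˡ (rotate 1# 0ᵛ)) (rotate-0ᵛ 1#))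

    to-t≡t : to t ≡ t
    to-t≡t = cong₂ _,_ k≡1 (≗⇒≡ λ j → trans (u≡0 j) (sym (lookup-0ᵛ j)))
      where
      open Σ (S-pins-image-of-t k w u w∈S₀ k≢0 t∈S e∙t∈S e⁻¹∙t∈S t∙t∈S) renaming (proj₁ to k≡1; proj₂ to u≡0)

    fixes-or-negates : (∀ g → to g ≡ g) ⊎ (∀ g → to g ≡ negateN g)
    fixes-or-negates = by-cases (IsSignedδ₀⇒±δ₀ w w∈S₀)
      where
      by-cases : w ≡ δ₀ ⊎ w ≡ -ᵛ δ₀ → (∀ g → to g ≡ g) ⊎ (∀ g → to g ≡ negateN g)
      by-cases (inj₁ w≡δ₀)  = inj₁ (fixes-t-and-e⇒identity to hom to-t≡t (trans to-e (cong (0# ,_) w≡δ₀)))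
      by-cases (inj₂ w≡-δ₀) = inj₂ λ g → begin
        to g                        ≡⟨ negateN-involutive (to g) ⟨
        negateN (negateN (to g))    ≡⟨ cong negateN (fixes-t-and-e⇒identity (negateN ∘ to) homo fixes-t fixes-e g) ⟩
        negateN g                   ∎
        where
        homo : ∀ x y → negateN (to (x ∙ y)) ≡ negateN (to x) ∙ negateN (to y)
        homo x y = trans (cong negateN (hom x y)) (negateN-homo (to x) (to y))
        fixes-t : negateN (to t) ≡ t
        fixes-t = trans (cong negateN to-t≡t) (cong (1# ,_) -ᵛ0ᵛ≡0ᵛ)
        fixes-e : negateN (to e) ≡ e
        fixes-e = trans (cong negateN (trans to-e (cong (0# ,_) w≡-δ₀))) (cong (0# ,_) (-ᵛ-involutive δ₀))

    is-identity : ∀ g → to g ≡ g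
    is-identity = Sum.[ (λ fixes → fixes) , (λ negates → ⊥-elim (negates-excluded negates)) ]′ fixes-or-negates
      where
      negates-excluded : ¬ (∀ g → to g ≡ negateN g)
      negates-excluded negates =
        -ones∉S₁ odd (InS-1# (image-∈S (1# , ones) (1# , -ᵛ ones) (over-1# refl ones∈S₁) (negates (1# , ones))))

  S-Aut-trivial : ¬ 2 ∣ p → AutGS-trivial (WreathData p) S
  S-Aut-trivial odd φ preserves-S = AutomorphismPreservingS.is-identity odd φ preserves-S

odd-prime : ∀ {p} → Prime p → p ≢ 2 → ¬ 2 ∣ p
odd-prime pp p≢2 2∣p with prime⇒irreducible pp 2∣p
... | inj₁ ()
... | inj₂ 2≡p = p≢2 (sym 2≡p)

theorem1p6 : (p : ℕ) → (pp : Prime p) → p ≢ 2 →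
    ¬ GRRDetecting (ZpWrZp p pp) × ¬ DRRDetecting (ZpWrZp p pp)
theorem1p6 zero                pp _   = ⊥-elim (¬prime[0] pp)
theorem1p6 (suc zero)          pp _   = ⊥-elim (¬prime[1] pp)
theorem1p6 (suc (suc zero))    _  p≢2 = ⊥-elim (p≢2 refl)
theorem1p6 (suc (suc (suc n))) pp p≢2 =
  (λ grr → S-not-DRR (proj₂ (grr S S-inverse-closed Aut-trivial))) ,
  (λ drr → S-not-DRR (drr S Aut-trivial))
  where
  open Counterexample n
  Aut-trivial : AutGS-trivial (WreathData p) S
  Aut-trivial = S-Aut-trivial (odd-prime pp p≢2)
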